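{- A finite vector configuration $B=\{b_1,\ldots,b_n\}\subseteq\mathbb{Z}^m$ is supernormal if and only if for every $c\in\mathbb{Z}^n$ for which the inequality system $b_i\cdot x\le c_i$ ($i=1,\ldots,n$) is tight, this system is totally dual integral.
   Context: $\mathrm{cone}(C)$ is the set of non-negative real combinations of a finite set $C$. $B$ is supernormal if for every subset $B'\subseteq B$, every point of $\mathrm{cone}(B')\cap\mathbb{Z}^m$ is a non-negative integer combination of $B\cap\mathrm{cone}(B')$. For $c\in\mathbb{Z}^n$ let $P_c=\{x\in\mathbb{R}^m : b_i\cdot x\le c_i,\ i=1,\ldots,n\}$. The system $b_i\cdot x\le c_i$ ($i=1,\ldots,n$) is tight if $P_{c-e_i}\cap\mathbb{Z}^m$ is strictly contained in $P_c\cap\mathbb{Z}^m$ for every unit vector $e_i\in\mathbb{Z}^n$ (equivalently, for each $i$ there is a lattice point $x\in P_c$ with $b_i\cdot x=c_i$). The system is totally dual integral (TDI) if for every $w\in\mathbb{Z}^m$ such that $\max\{w\cdot x : x\in P_c\}$ is finite, the dual linear program $\min\{\sum_i y_ic_i : y\in\mathbb{R}^n,\ y\ge0,\ \sum_i y_ib_i=w\}$ has an integral optimal solution.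
   Formalization: The coefficients of cone combinations, the points of $P_c$, the upper bound on $w\cdot x$ and the dual variables $y$ are taken over the rationals instead of the reals. -}

module Defs where

open import Data.Nat as ℕ using (ℕ)
open import Data.Integer as ℤ using (ℤ; +_)
open import Data.Rational as ℚ using (ℚ; 0ℚ)
open import Data.Fin using (Fin; zero; suc)
open import Data.Fin.Subset using (Subset; _∈_; _∉_)
open import Data.Product using (Σ; ∃; _×_; _,_)
open import Relation.Binary.PropositionalEquality using (_≡_; _≢_)
open import Relation.Nullary using (¬_)
open import Function.Definitions using (Injective)

toℚ : ℤ → ℚ
toℚ z = z ℚ./ 1

sumℚ : ∀ {k} → (Fin k → ℚ) → ℚ
sumℚ {ℕ.zero}  f = 0ℚ
sumℚ {ℕ.suc k} f = f zero ℚ.+ sumℚ (λ i → f (suc i))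

sumℤ : ∀ {k} → (Fin k → ℤ) → ℤ
sumℤ {ℕ.zero}  f = + 0
sumℤ {ℕ.suc k} f = f zero ℤ.+ sumℤ (λ i → f (suc i))

-- a vector configuration b_1,…,b_n in ℤ^m (indexed family)
Config : ℕ → ℕ → Set
Config m n = Fin n → Fin m → ℤ

dotℚ : ∀ {m} → (Fin m → ℤ) → (Fin m → ℚ) → ℚ
dotℚ b x = sumℚ (λ k → toℚ (b k) ℚ.* x k)

dotℤ : ∀ {m} → (Fin m → ℤ) → (Fin m → ℤ) → ℤ
dotℤ b x = sumℤ (λ k → b k ℤ.* x k)

InCone : ∀ {m n} → Config m n → Subset n → (Fin m → ℚ) → Set
InCone {m} {n} B B' x =
  Σ (Fin n → ℚ) λ l →
    (∀ i → 0ℚ ℚ.≤ l i) ×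
    (∀ i → i ∉ B' → l i ≡ 0ℚ) ×
    (∀ k → x k ≡ sumℚ (λ i → l i ℚ.* toℚ (B i k)))

Supernormal : ∀ {m n} → Config m n → Set
Supernormal {m} {n} B =
  (B' : Subset n) (z : Fin m → ℤ) →
  InCone B B' (λ k → toℚ (z k)) →
  Σ (Fin n → ℕ) λ μ →
    (∀ j → μ j ≢ 0 → InCone B B' (λ k → toℚ (B j k))) ×
    (∀ k → z k ≡ sumℤ (λ j → + μ j ℤ.* B j k))

InP : ∀ {m n} → Config m n → (Fin n → ℤ) → (Fin m → ℚ) → Set
InP B c x = ∀ i → dotℚ (B i) x ℚ.≤ toℚ (c i)

InPℤ : ∀ {m n} → Config m n → (Fin n → ℤ) → (Fin m → ℤ) → Set
InPℤ B c x = ∀ i → dotℤ (B i) x ℤ.≤ c i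

Tight : ∀ {m n} → Config m n → (Fin n → ℤ) → Set
Tight {m} {n} B c = ∀ i → Σ (Fin m → ℤ) λ x → InPℤ B c x × dotℤ (B i) x ≡ c i

-- max { w · x : x ∈ P_c } is finite: P_c nonempty and w bounded above on P_c
MaxFinite : ∀ {m n} → Config m n → (Fin n → ℤ) → (Fin m → ℤ) → Set
MaxFinite {m} B c w =
  (Σ (Fin m → ℚ) λ x → InP B c x) ×
  (Σ ℚ λ M → ∀ x → InP B c x → dotℚ w x ℚ.≤ M)

DualFeasible : ∀ {m n} → Config m n → (Fin m → ℤ) → (Fin n → ℚ) → Set
DualFeasible B w y =
  (∀ i → 0ℚ ℚ.≤ y i) × (∀ k → toℚ (w k) ≡ sumℚ (λ i → y i ℚ.* toℚ (B i k)))

dualValue : ∀ {n} → (Fin n → ℤ) → (Fin n → ℚ) → ℚ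
dualValue c y = sumℚ (λ i → y i ℚ.* toℚ (c i))

HasIntegralDualOpt : ∀ {m n} → Config m n → (Fin n → ℤ) → (Fin m → ℤ) → Set
HasIntegralDualOpt {m} {n} B c w =
  Σ (Fin n → ℤ) λ y →
    DualFeasible B w (λ i → toℚ (y i)) ×
    (∀ y' → DualFeasible B w y' → dualValue c (λ i → toℚ (y i)) ℚ.≤ dualValue c y')

TDI : ∀ {m n} → Config m n → (Fin n → ℤ) → Set
TDI {m} B c = (w : Fin m → ℤ) → MaxFinite B c w → HasIntegralDualOpt B c w

{-# OPTIONS --safe #-}
-- Both directions rest on linear programming duality over ℚ, derived from Farkas' lemma, which
-- in turn comes from Fourier–Motzkin elimination.
-- (⇒) For w with a finite maximum take an optimal x and an optimal dual y. By complementary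
-- slackness w lies in the cone of the bᵢ active at x, so supernormality writes w as a
-- non-negative integral combination of the bⱼ in that cone. By tightness every such bⱼ is active
-- at x, hence this integral combination has value w·x and is dual optimal.
-- (⇐) Given z in cone(B′), separate each bⱼ ∉ cone(B′) from cone(B′) by a lattice point and let c
-- be the tight right-hand side spanned by these points and 0. Total dual integrality for w = z
-- gives an integral optimum of value 0, which must vanish on every bⱼ ∉ cone(B′).
module Submission where

open import Defs
open import Data.Nat using (ℕ)
open import Data.Integer using (ℤ)
open import Data.Fin using (Fin)
open import Function.Definitions using (Injective)
open import Relation.Binary.PropositionalEquality using (_≡_)
open import Function.Bundles using (_⇔_; mk⇔)

open import Data.Nat as ℕ using (zero; suc)
import Data.Nat.Properties as ℕ
import Data.Nat.Coprimality as C
open import Data.Integer as ℤ using ()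
import Data.Integer.Properties as ℤ
open import Data.Integer.Solver renaming (module +-*-Solver to ℤ-Solver)
open import Data.Rational as ℚ using (ℚ; 0ℚ; 1ℚ; mkℚ; _+_; _*_; -_; _-_; _≤_; _<_)
import Data.Rational.Properties as ℚ
import Data.Rational.Unnormalised as ℚᵘ
import Data.Rational.Unnormalised.Properties as ℚᵘ
open import Data.Rational.Solver renaming (module +-*-Solver to ℚ-Solver)
open import Data.Fin using (zero; suc; _↑ˡ_; _↑ʳ_)
open import Data.Vec.Functional using (Vector; _++_; _∷_)
open import Relation.Binary.Bundles using (DecTotalOrder)
open import Algebra.Properties.Group ℚ.+-0-group using () renaming (⁻¹-involutive to neg-involutive)
open import Data.List as List using (List; [])
open import Data.List.Membership.Propositional using (find; lose) renaming (_∈_ to _∈ₗ_)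
open import Data.List.Membership.Propositional.Properties
  using (∈-++⁻; ∈-++⁺ˡ; ∈-++⁺ʳ; ∈-map⁻; ∈-map⁺; ∈-cartesianProductWith⁻; ∈-cartesianProductWith⁺;
         ∈-map∘filter⁻; ∈-map∘filter⁺; ∈-tabulate⁻; ∈-tabulate⁺)
open import Data.List.Relation.Unary.Any using (here; there; any?)
import Data.List.Relation.Unary.All as All
import Data.List.Relation.Unary.All.Properties as All
open import Data.List.Extrema ℤ.≤-totalOrder
  using () renaming (max to ℤ-max; xs≤max to ℤ-xs≤max; ⊥≤max to ℤ-⊥≤max; max≤v⁺ to ℤ-max≤v⁺; argmax-sel to ℤ-argmax-sel)
open import Data.List.Extrema (DecTotalOrder.totalOrder ℚ.≤-decTotalOrder)
  using () renaming (max to ℚ-max; min to ℚ-min; xs≤max to ℚ-xs≤max; v≤min⁺ to ℚ-v≤min⁺; min≤⊤ to ℚ-min≤⊤; min≤xs to ℚ-min≤xs)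
open import Data.Vec.Functional.Properties using (lookup-++ˡ; lookup-++ʳ)
open import Data.Fin.Subset using (Subset; _∈_; _∉_; inside; outside)
import Data.Vec as Vec
open import Data.Fin.Subset.Properties using (_∈?_)
open import Data.Product using (Σ-syntax; _×_; _,_; proj₁; proj₂)
open import Data.Sum using (_⊎_; inj₁; inj₂; [_,_]′)
open import Function using (_∘_; id)
open import Data.Empty using (⊥; ⊥-elim)
open import Relation.Nullary using (Dec; yes; no; ¬_)
open import Relation.Binary.Definitions using (tri<; tri≈; tri>)
open import Relation.Binary.PropositionalEquality
  using (_≢_; refl; sym; trans; cong; cong₂; subst; subst₂; module ≡-Reasoning)

private
  variable
    m n N : ℕ
    a b h : ℚ
    i j : ℤ

+-nonneg : 0ℚ ≤ a → 0ℚ ≤ b → 0ℚ ≤ a + b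
+-nonneg = ℚ.+-mono-≤

*-nonneg : 0ℚ ≤ a → 0ℚ ≤ b → 0ℚ ≤ a * b
*-nonneg {a} {b} 0≤a 0≤b =
  ℚ.nonNegative⁻¹ _ {{ℚ.nonNeg*nonNeg⇒nonNeg a {{ℚ.nonNegative 0≤a}} b {{ℚ.nonNegative 0≤b}}}}

*-pos : 0ℚ < a → 0ℚ < b → 0ℚ < a * b
*-pos {a} {b} 0<a 0<b = ℚ.positive⁻¹ _ {{ℚ.pos*pos⇒pos a {{ℚ.positive 0<a}} b {{ℚ.positive 0<b}}}}

neg-cancel-≤ : - a ≤ - b → b ≤ a
neg-cancel-≤ {a} {b} -a≤-b = subst₂ _≤_ (neg-involutive b) (neg-involutive a) (ℚ.neg-antimono-≤ -a≤-b)

neg-cancel-< : - a < - b → b < a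
neg-cancel-< {a} {b} -a<-b = subst₂ _<_ (neg-involutive b) (neg-involutive a) (ℚ.neg-antimono-< -a<-b)

p<p+1 : ∀ a → a < a + 1ℚ
p<p+1 a = subst (_< a + 1ℚ) (ℚ.+-identityʳ a) (ℚ.+-monoʳ-< a (ℚ.positive⁻¹ 1ℚ))

*-monoˡ-≤-nonneg : ∀ {q a b} → 0ℚ ≤ q → a ≤ b → q * a ≤ q * b
*-monoˡ-≤-nonneg {q} 0≤q = ℚ.*-monoˡ-≤-nonNeg q {{ℚ.nonNegative 0≤q}}

-- The reciprocal, made total by 0 ⁻¹ = 0.
_⁻¹ : ℚ → ℚ
a ⁻¹ with a ℚ.≟ 0ℚ
... | yes _   = 0ℚ
... | no  a≢0 = ℚ.1/_ a {{ℚ.≢-nonZero a≢0}}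

⁻¹-inverseʳ : 0ℚ < a → a * a ⁻¹ ≡ 1ℚ
⁻¹-inverseʳ {a} 0<a with a ℚ.≟ 0ℚ
... | yes a≡0 = ⊥-elim (ℚ.<-irrefl (sym a≡0) 0<a)
... | no  a≢0 = ℚ.*-inverseʳ a {{ℚ.≢-nonZero a≢0}}

⁻¹-inverseˡ : 0ℚ < a → a ⁻¹ * a ≡ 1ℚ
⁻¹-inverseˡ {a} 0<a = trans (ℚ.*-comm (a ⁻¹) a) (⁻¹-inverseʳ 0<a)

⁻¹-pos : 0ℚ < a → 0ℚ < a ⁻¹
⁻¹-pos {a} 0<a with a ℚ.≟ 0ℚ
... | yes a≡0 = ⊥-elim (ℚ.<-irrefl (sym a≡0) 0<a)
... | no  a≢0 = ℚ.positive⁻¹ _ {{ℚ.1/pos⇒pos a {{ℚ.positive 0<a}}}}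

*-⁻¹-cancel : 0ℚ < h → h * (h ⁻¹ * a) ≡ a
*-⁻¹-cancel {h} {a} 0<h =
  trans (sym (ℚ.*-assoc h (h ⁻¹) a)) (trans (cong (_* a) (⁻¹-inverseʳ 0<h)) (ℚ.*-identityˡ a))

≤∧≢⇒< : a ≤ b → a ≢ b → a < b
≤∧≢⇒< {a} {b} a≤b a≢b with ℚ.<-cmp a b
... | tri< a<b _ _ = a<b
... | tri≈ _ a≡b _ = ⊥-elim (a≢b a≡b)
... | tri> _ _ b<a = ⊥-elim (ℚ.<-irrefl refl (ℚ.<-≤-trans b<a a≤b))

*≡0⇒≡0 : a * b ≡ 0ℚ → 0ℚ < b → a ≡ 0ℚ
*≡0⇒≡0 {a} {b} ab≡0 0<b = begin
  a                  ≡⟨ ℚ.*-identityʳ a ⟨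
  a * 1ℚ             ≡⟨ cong (a *_) (⁻¹-inverseʳ 0<b) ⟨
  a * (b * b ⁻¹)     ≡⟨ ℚ.*-assoc a b (b ⁻¹) ⟨
  a * b * b ⁻¹       ≡⟨ cong (_* b ⁻¹) ab≡0 ⟩
  0ℚ * b ⁻¹          ≡⟨ ℚ.*-zeroˡ (b ⁻¹) ⟩
  0ℚ                 ∎
  where open ≡-Reasoning

toℚ≡mkℚ : ∀ i → toℚ i ≡ mkℚ i 0 (C.sym (C.1-coprimeTo ℤ.∣ i ∣))
toℚ≡mkℚ i = ℚ.fromℚᵘ-toℚᵘ (mkℚ i 0 _)

toℚ-mono-≤ : i ℤ.≤ j → toℚ i ≤ toℚ j
toℚ-mono-≤ {i} {j} i≤j rewrite toℚ≡mkℚ i | toℚ≡mkℚ j = ℚ.*≤* (ℤ.*-monoʳ-≤-nonNeg (ℤ.+ 1) i≤j)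

toℚ-cancel-≤ : toℚ i ≤ toℚ j → i ℤ.≤ j
toℚ-cancel-≤ {i} {j} i≤j rewrite toℚ≡mkℚ i | toℚ≡mkℚ j with i≤j
... | ℚ.*≤* i*1≤j*1 = subst₂ ℤ._≤_ (ℤ.*-identityʳ i) (ℤ.*-identityʳ j) i*1≤j*1

toℚ-mono-< : i ℤ.< j → toℚ i < toℚ j
toℚ-mono-< {i} {j} i<j rewrite toℚ≡mkℚ i | toℚ≡mkℚ j =
  ℚ.*<* (subst₂ ℤ._<_ (sym (ℤ.*-identityʳ i)) (sym (ℤ.*-identityʳ j)) i<j)

toℚ-cancel-< : toℚ i < toℚ j → i ℤ.< j
toℚ-cancel-< {i} {j} i<j rewrite toℚ≡mkℚ i | toℚ≡mkℚ j with i<j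
... | ℚ.*<* i*1<j*1 = subst₂ ℤ._<_ (ℤ.*-identityʳ i) (ℤ.*-identityʳ j) i*1<j*1

toℚ-injective : toℚ i ≡ toℚ j → i ≡ j
toℚ-injective eq = ℤ.≤-antisym (toℚ-cancel-≤ (ℚ.≤-reflexive eq)) (toℚ-cancel-≤ (ℚ.≤-reflexive (sym eq)))

private
  toℚᵘ-toℚ : ∀ i → ℚ.toℚᵘ (toℚ i) ℚᵘ.≃ ℚᵘ.mkℚᵘ i 0
  toℚᵘ-toℚ i = ℚ.toℚᵘ-fromℚᵘ (ℚᵘ.mkℚᵘ i 0)

toℚ-+ : ∀ i j → toℚ (i ℤ.+ j) ≡ toℚ i + toℚ j
toℚ-+ i j = ℚ.toℚᵘ-injective (begin
  ℚ.toℚᵘ (toℚ (i ℤ.+ j))                  ≈⟨ toℚᵘ-toℚ (i ℤ.+ j) ⟩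
  ℚᵘ.mkℚᵘ (i ℤ.+ j) 0                     ≈⟨ ℚᵘ.*≡* (solve 2 (λ i j → (i :+ j) :* 1ℤ := (i :* 1ℤ :+ j :* 1ℤ) :* 1ℤ) refl i j) ⟩
  ℚᵘ.mkℚᵘ i 0 ℚᵘ.+ ℚᵘ.mkℚᵘ j 0            ≈⟨ ℚᵘ.+-cong (ℚᵘ.≃-sym (toℚᵘ-toℚ i)) (ℚᵘ.≃-sym (toℚᵘ-toℚ j)) ⟩
  ℚ.toℚᵘ (toℚ i) ℚᵘ.+ ℚ.toℚᵘ (toℚ j)     ≈⟨ ℚᵘ.≃-sym (ℚ.toℚᵘ-homo-+ (toℚ i) (toℚ j)) ⟩
  ℚ.toℚᵘ (toℚ i + toℚ j)                  ∎)
  where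
  open import Relation.Binary.Reasoning.Setoid ℚᵘ.≃-setoid
  open ℤ-Solver
  1ℤ = con (ℤ.+ 1)

toℚ-* : ∀ i j → toℚ (i ℤ.* j) ≡ toℚ i * toℚ j
toℚ-* i j = ℚ.toℚᵘ-injective (begin
  ℚ.toℚᵘ (toℚ (i ℤ.* j))                  ≈⟨ toℚᵘ-toℚ (i ℤ.* j) ⟩
  ℚᵘ.mkℚᵘ (i ℤ.* j) 0                     ≈⟨ ℚᵘ.*≡* refl ⟩
  ℚᵘ.mkℚᵘ i 0 ℚᵘ.* ℚᵘ.mkℚᵘ j 0            ≈⟨ ℚᵘ.*-cong (ℚᵘ.≃-sym (toℚᵘ-toℚ i)) (ℚᵘ.≃-sym (toℚᵘ-toℚ j)) ⟩
  ℚ.toℚᵘ (toℚ i) ℚᵘ.* ℚ.toℚᵘ (toℚ j)     ≈⟨ ℚᵘ.≃-sym (ℚ.toℚᵘ-homo-* (toℚ i) (toℚ j)) ⟩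
  ℚ.toℚᵘ (toℚ i * toℚ j)                  ∎)
  where open import Relation.Binary.Reasoning.Setoid ℚᵘ.≃-setoid

sumℚ-cong : {f g : Vector ℚ n} → (∀ i → f i ≡ g i) → sumℚ f ≡ sumℚ g
sumℚ-cong {zero}  f≗g = refl
sumℚ-cong {suc n} f≗g = cong₂ _+_ (f≗g zero) (sumℚ-cong (λ i → f≗g (suc i)))

sumℚ-zero : sumℚ {n} (λ _ → 0ℚ) ≡ 0ℚ
sumℚ-zero {zero}  = refl
sumℚ-zero {suc n} = cong (0ℚ +_) (sumℚ-zero {n})

sumℚ-+ : ∀ (f g : Vector ℚ n) → sumℚ (λ i → f i + g i) ≡ sumℚ f + sumℚ g
sumℚ-+ {zero}  f g = refl
sumℚ-+ {suc n} f g = trans (cong (f zero + g zero +_) (sumℚ-+ (λ i → f (suc i)) (λ i → g (suc i))))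
  (solve 4 (λ a b c d → (a :+ b) :+ (c :+ d) := (a :+ c) :+ (b :+ d)) refl (f zero) (g zero) _ _)
  where open ℚ-Solver

*-distribˡ-sumℚ : ∀ q (f : Vector ℚ n) → q * sumℚ f ≡ sumℚ (λ i → q * f i)
*-distribˡ-sumℚ {zero}  q f = ℚ.*-zeroʳ q
*-distribˡ-sumℚ {suc n} q f =
  trans (ℚ.*-distribˡ-+ q (f zero) _) (cong (q * f zero +_) (*-distribˡ-sumℚ q (λ i → f (suc i))))

neg-sumℚ : ∀ (f : Vector ℚ n) → - sumℚ f ≡ sumℚ (λ i → - f i)
neg-sumℚ {zero}  f = refl
neg-sumℚ {suc n} f = trans (ℚ.neg-distrib-+ (f zero) _) (cong (- f zero +_) (neg-sumℚ (λ i → f (suc i))))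

sumℚ-comm : ∀ (f : Fin m → Fin n → ℚ) →
  sumℚ (λ i → sumℚ (λ j → f i j)) ≡ sumℚ (λ j → sumℚ (λ i → f i j))
sumℚ-comm {zero} {n} f = sym (sumℚ-zero {n})
sumℚ-comm {suc m} f = trans (cong (sumℚ (f zero) +_) (sumℚ-comm (λ i → f (suc i))))
  (sym (sumℚ-+ (f zero) (λ j → sumℚ (λ i → f (suc i) j))))

sumℚ-mono-≤ : {f g : Vector ℚ n} → (∀ i → f i ≤ g i) → sumℚ f ≤ sumℚ g
sumℚ-mono-≤ {zero}  f≤g = ℚ.≤-refl
sumℚ-mono-≤ {suc n} f≤g = ℚ.+-mono-≤ (f≤g zero) (sumℚ-mono-≤ (λ i → f≤g (suc i)))

sumℚ-nonneg : {f : Vector ℚ n} → (∀ i → 0ℚ ≤ f i) → 0ℚ ≤ sumℚ f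
sumℚ-nonneg {n} {f} 0≤f = subst (_≤ sumℚ f) (sumℚ-zero {n}) (sumℚ-mono-≤ 0≤f)

sumℚ≤0⇒≡0 : {f : Vector ℚ n} → (∀ i → 0ℚ ≤ f i) → sumℚ f ≤ 0ℚ → ∀ i → f i ≡ 0ℚ
sumℚ≤0⇒≡0 {suc n} {f} 0≤f ∑f≤0 zero = ℚ.≤-antisym (begin
  f zero                               ≡⟨ sym (ℚ.+-identityʳ (f zero)) ⟩
  f zero + 0ℚ                          ≤⟨ ℚ.+-monoʳ-≤ (f zero) (sumℚ-nonneg (λ i → 0≤f (suc i))) ⟩
  f zero + sumℚ (λ i → f (suc i))      ≤⟨ ∑f≤0 ⟩
  0ℚ                                   ∎) (0≤f zero)
  where open ℚ.≤-Reasoning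
sumℚ≤0⇒≡0 {suc n} {f} 0≤f ∑f≤0 (suc i) = sumℚ≤0⇒≡0 (λ i → 0≤f (suc i)) (begin
  sumℚ (λ i → f (suc i))               ≡⟨ sym (ℚ.+-identityˡ _) ⟩
  0ℚ + sumℚ (λ i → f (suc i))          ≤⟨ ℚ.+-monoˡ-≤ _ (0≤f zero) ⟩
  f zero + sumℚ (λ i → f (suc i))      ≤⟨ ∑f≤0 ⟩
  0ℚ                                   ∎) i
  where open ℚ.≤-Reasoning

sumℚ-↑ : ∀ m (f : Vector ℚ (m ℕ.+ n)) → sumℚ f ≡ sumℚ (λ i → f (i ↑ˡ n)) + sumℚ (λ j → f (m ↑ʳ j))
sumℚ-↑ zero    f = sym (ℚ.+-identityˡ _)
sumℚ-↑ (suc m) f = trans (cong (f zero +_) (sumℚ-↑ m (λ i → f (suc i)))) (sym (ℚ.+-assoc (f zero) _ _))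

δ : Fin n → Vector ℚ n
δ zero    zero    = 1ℚ
δ zero    (suc j) = 0ℚ
δ (suc i) zero    = 0ℚ
δ (suc i) (suc j) = δ i j

δ-nonneg : ∀ (i j : Fin n) → 0ℚ ≤ δ i j
δ-nonneg zero    zero    = ℚ.nonNegative⁻¹ 1ℚ
δ-nonneg zero    (suc j) = ℚ.≤-refl
δ-nonneg (suc i) zero    = ℚ.≤-refl
δ-nonneg (suc i) (suc j) = δ-nonneg i j

sumℚ-δ : ∀ (i : Fin n) (f : Vector ℚ n) → sumℚ (λ j → δ i j * f j) ≡ f i
sumℚ-δ {suc n} zero f = begin
  1ℚ * f zero + sumℚ (λ j → 0ℚ * f (suc j))   ≡⟨ cong₂ _+_ (ℚ.*-identityˡ (f zero)) (sumℚ-cong (λ j → ℚ.*-zeroˡ (f (suc j)))) ⟩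
  f zero + sumℚ {n} (λ _ → 0ℚ)                 ≡⟨ cong (f zero +_) (sumℚ-zero {n}) ⟩
  f zero + 0ℚ                                  ≡⟨ ℚ.+-identityʳ (f zero) ⟩
  f zero                                       ∎
  where open ≡-Reasoning
sumℚ-δ {suc n} (suc i) f = trans (cong (_+ sumℚ (λ j → δ i j * f (suc j))) (ℚ.*-zeroˡ (f zero)))
  (trans (ℚ.+-identityˡ _) (sumℚ-δ i (λ j → f (suc j))))

toℚ-sumℤ : ∀ (f : Vector ℤ n) → toℚ (sumℤ f) ≡ sumℚ (λ i → toℚ (f i))
toℚ-sumℤ {zero}  f = refl
toℚ-sumℤ {suc n} f = trans (toℚ-+ (f zero) _) (cong (toℚ (f zero) +_) (toℚ-sumℤ (λ i → f (suc i))))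

dot : Vector ℚ n → Vector ℚ n → ℚ
dot a x = sumℚ (λ k → a k * x k)

toℚ-dotℤ : ∀ (b x : Vector ℤ n) → toℚ (dotℤ b x) ≡ dotℚ b (λ k → toℚ (x k))
toℚ-dotℤ b x = trans (toℚ-sumℤ (λ k → b k ℤ.* x k)) (sumℚ-cong (λ k → toℚ-* (b k) (x k)))

dot-zeroˡ : ∀ (x : Vector ℚ n) → dot (λ _ → 0ℚ) x ≡ 0ℚ
dot-zeroˡ {n} x = trans (sumℚ-cong (λ k → ℚ.*-zeroˡ (x k))) (sumℚ-zero {n})

dot-zeroʳ : ∀ (a : Vector ℚ n) → dot a (λ _ → 0ℚ) ≡ 0ℚ
dot-zeroʳ {n} a = trans (sumℚ-cong (λ k → ℚ.*-zeroʳ (a k))) (sumℚ-zero {n})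

dot-*ˡ : ∀ q (a x : Vector ℚ n) → dot (λ k → q * a k) x ≡ q * dot a x
dot-*ˡ q a x = trans (sumℚ-cong (λ k → ℚ.*-assoc q (a k) (x k))) (sym (*-distribˡ-sumℚ q (λ k → a k * x k)))

dot-negˡ : ∀ (a x : Vector ℚ n) → dot (λ k → - a k) x ≡ - dot a x
dot-negˡ a x = trans (sumℚ-cong (λ k → sym (ℚ.neg-distribˡ-* (a k) (x k)))) (sym (neg-sumℚ (λ k → a k * x k)))

dot-+ˡ : ∀ (a b x : Vector ℚ n) → dot (λ k → a k + b k) x ≡ dot a x + dot b x
dot-+ˡ a b x = trans (sumℚ-cong (λ k → ℚ.*-distribʳ-+ (x k) (a k) (b k))) (sumℚ-+ (λ k → a k * x k) (λ k → b k * x k))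

dot-negʳ : ∀ (a x : Vector ℚ n) → dot a (λ k → - x k) ≡ - dot a x
dot-negʳ a x = trans (sumℚ-cong (λ k → sym (ℚ.neg-distribʳ-* (a k) (x k)))) (sym (neg-sumℚ (λ k → a k * x k)))

dot-comm : ∀ (a x : Vector ℚ n) → dot a x ≡ dot x a
dot-comm a x = sumℚ-cong (λ k → ℚ.*-comm (a k) (x k))

dot-ray : ∀ (a x d : Vector ℚ n) s → dot a (λ k → x k + s * d k) ≡ dot a x + s * dot a d
dot-ray a x d s = begin
  sumℚ (λ k → a k * (x k + s * d k))         ≡⟨ sumℚ-cong (λ k → distrib (a k) (x k) s (d k)) ⟩
  sumℚ (λ k → a k * x k + s * (a k * d k))   ≡⟨ sumℚ-+ (λ k → a k * x k) (λ k → s * (a k * d k)) ⟩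
  dot a x + sumℚ (λ k → s * (a k * d k))     ≡⟨ cong (dot a x +_) (sym (*-distribˡ-sumℚ s (λ k → a k * d k))) ⟩
  dot a x + s * dot a d                      ∎
  where
  open ≡-Reasoning
  open ℚ-Solver
  distrib : ∀ a x s d → a * (x + s * d) ≡ a * x + s * (a * d)
  distrib = solve 4 (λ a x s d → a :* (x :+ s :* d) := a :* x :+ s :* (a :* d)) refl

dot-lincomb : ∀ (A : Fin N → Vector ℚ n) (y : Vector ℚ N) {w} x →
  (∀ k → w k ≡ sumℚ (λ i → y i * A i k)) → dot w x ≡ sumℚ (λ i → y i * dot (A i) x)
dot-lincomb A y {w} x w≡yA = begin
  sumℚ (λ k → w k * x k)                          ≡⟨ sumℚ-cong (λ k → cong (_* x k) (w≡yA k)) ⟩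
  sumℚ (λ k → sumℚ (λ i → y i * A i k) * x k)    ≡⟨ sumℚ-cong (λ k → ℚ.*-comm _ (x k)) ⟩
  sumℚ (λ k → x k * sumℚ (λ i → y i * A i k))    ≡⟨ sumℚ-cong (λ k → *-distribˡ-sumℚ (x k) (λ i → y i * A i k)) ⟩
  sumℚ (λ k → sumℚ (λ i → x k * (y i * A i k)))  ≡⟨ sumℚ-comm (λ k i → x k * (y i * A i k)) ⟩
  sumℚ (λ i → sumℚ (λ k → x k * (y i * A i k)))  ≡⟨ sumℚ-cong (λ i → sumℚ-cong (λ k → reorder (x k) (y i) (A i k))) ⟩
  sumℚ (λ i → sumℚ (λ k → y i * (A i k * x k)))  ≡⟨ sumℚ-cong (λ i → sym (*-distribˡ-sumℚ (y i) (λ k → A i k * x k))) ⟩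
  sumℚ (λ i → y i * dot (A i) x)                  ∎
  where
  open ≡-Reasoning
  open ℚ-Solver
  reorder : ∀ x y a → x * (y * a) ≡ y * (a * x)
  reorder = solve 3 (λ x y a → x :* (y :* a) := y :* (a :* x)) refl

dot-++ : ∀ (a : Vector ℚ m) (b : Vector ℚ n) z →
  dot (a ++ b) z ≡ dot a (λ k → z (k ↑ˡ n)) + dot b (λ j → z (m ↑ʳ j))
dot-++ {m} a b z = trans (sumℚ-↑ m (λ k → (a ++ b) k * z k)) (cong₂ _+_
  (sumℚ-cong (λ k → cong (_* _) (lookup-++ˡ a b k)))
  (sumℚ-cong (λ j → cong (_* _) (lookup-++ʳ a b j))))

-- Fourier–Motzkin elimination and Farkas' lemma

Ineq : ℕ → Set
Ineq m = Vector ℚ m × ℚ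

infix  4 _⊨_ _≐_
infixl 6 _⊕_
infixl 7 _⊙_

_⊨_ : Vector ℚ m → Ineq m → Set
x ⊨ (a , β) = dot a x ≤ β

_≐_ : Ineq m → Ineq m → Set
(a , β) ≐ (a′ , β′) = (∀ k → a k ≡ a′ k) × β ≡ β′

0≤0 : Ineq m
0≤0 = (λ _ → 0ℚ) , 0ℚ

_⊕_ : Ineq m → Ineq m → Ineq m
(a , β) ⊕ (a′ , β′) = (λ k → a k + a′ k) , β + β′

_⊙_ : ℚ → Ineq m → Ineq m
q ⊙ (a , β) = (λ k → q * a k) , q * β

data Derivable (R : Ineq m → Set) : Ineq m → Set where
  hyp   : ∀ {r} → R r → Derivable R r
  triv  : Derivable R 0≤0
  add   : ∀ {r s} → Derivable R r → Derivable R s → Derivable R (r ⊕ s)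
  scale : ∀ {r} q → 0ℚ ≤ q → Derivable R r → Derivable R (q ⊙ r)
  resp  : ∀ {r s} → r ≐ s → Derivable R r → Derivable R s

Solvable : (Ineq m → Set) → Set
Solvable {m} R = Σ[ x ∈ Vector ℚ m ] (∀ {r} → R r → x ⊨ r)

Refutable : (Ineq m → Set) → Set
Refutable R = Σ[ β ∈ ℚ ] β < 0ℚ × Derivable R ((λ _ → 0ℚ) , β)

upper-bound : ∀ {h x s β} → 0ℚ < h → x ≤ h ⁻¹ * (β - s) → h * x + s ≤ β
upper-bound {h} {x} {s} {β} 0<h x≤ = begin
  h * x + s                  ≤⟨ ℚ.+-monoˡ-≤ s (*-monoˡ-≤-nonneg (ℚ.<⇒≤ 0<h) x≤) ⟩
  h * (h ⁻¹ * (β - s)) + s   ≡⟨ cong (_+ s) (*-⁻¹-cancel 0<h) ⟩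
  β - s + s                  ≡⟨ solve 2 (λ β s → β :- s :+ s := β) refl β s ⟩
  β                          ∎
  where
  open ℚ.≤-Reasoning
  open ℚ-Solver

lower-bound : ∀ {h x s β} → h < 0ℚ → (- h) ⁻¹ * (s - β) ≤ x → h * x + s ≤ β
lower-bound {h} {x} {s} {β} h<0 ≤x = begin
  h * x + s                            ≡⟨ solve 4 (λ h x s β → h :* x :+ s := (s :- β) :+ (h :* x :+ β)) refl h x s β ⟩
  (s - β) + (h * x + β)                ≡⟨ cong (_+ (h * x + β)) (*-⁻¹-cancel 0<-h) ⟨
  - h * ((- h) ⁻¹ * (s - β)) + (h * x + β)
                                       ≤⟨ ℚ.+-monoˡ-≤ (h * x + β) (*-monoˡ-≤-nonneg (ℚ.<⇒≤ 0<-h) ≤x) ⟩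
  - h * x + (h * x + β)                ≡⟨ solve 3 (λ h x β → :- h :* x :+ (h :* x :+ β) := β) refl h x β ⟩
  β                                    ∎
  where
  open ℚ.≤-Reasoning
  open ℚ-Solver
  0<-h : 0ℚ < - h
  0<-h = ℚ.neg-antimono-< h<0

exists-between : (Lo Up : List ℚ) → (∀ {l u} → l ∈ₗ Lo → u ∈ₗ Up → l ≤ u) →
  Σ[ x ∈ ℚ ] (∀ {l} → l ∈ₗ Lo → l ≤ x) × (∀ {u} → u ∈ₗ Up → x ≤ u)
exists-between Lo []       _   = ℚ-max 0ℚ Lo , All.lookup (ℚ-xs≤max 0ℚ Lo) , λ ()
exists-between Lo (u List.∷ Up) l≤u = ℚ-min u Up ,
  (λ l∈Lo → ℚ-v≤min⁺ (l≤u l∈Lo (here refl)) (All.tabulate (λ u′∈Up → l≤u l∈Lo (there u′∈Up)))) ,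
  λ { (here refl) → ℚ-min≤⊤ u Up ; (there u′∈Up) → All.lookup (ℚ-min≤xs u Up) u′∈Up }

module FourierMotzkin {m : ℕ} where

  hd : Ineq (suc m) → ℚ
  hd (a , _) = a zero

  tl : Ineq (suc m) → Ineq m
  tl (a , β) = (λ k → a (suc k)) , β

  lift : Ineq m → Ineq (suc m)
  lift (a , β) = (0ℚ ∷ a) , β

  lift-tl : ∀ r → hd r ≡ 0ℚ → r ≐ lift (tl r)
  lift-tl r hd≡0 = (λ { zero → hd≡0 ; (suc k) → refl }) , refl

  lift-0≤0 : ∀ {R} → Derivable R (lift 0≤0)
  lift-0≤0 = resp ((λ { zero → refl ; (suc k) → refl }) , refl) triv

  cancel : Ineq (suc m) → Ineq (suc m) → Ineq (suc m)
  cancel p q = hd p ⁻¹ ⊙ p ⊕ (- hd q) ⁻¹ ⊙ q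

  -- Pairs not of opposite signs, and rows with nonzero head in `drop`, contribute the trivial 0 ≤ 0.
  combine : Ineq (suc m) → Ineq (suc m) → Ineq m
  combine p q with 0ℚ ℚ.<? hd p | hd q ℚ.<? 0ℚ
  ... | yes _ | yes _ = tl (cancel p q)
  ... | _     | _     = 0≤0

  drop : Ineq (suc m) → Ineq m
  drop r with hd r ℚ.≟ 0ℚ
  ... | yes _ = tl r
  ... | no  _ = 0≤0

  eliminate : List (Ineq (suc m)) → List (Ineq m)
  eliminate L = List.cartesianProductWith combine L L List.++ List.map drop L

  hd-cancel : ∀ p q → 0ℚ < hd p → hd q < 0ℚ → hd (cancel p q) ≡ 0ℚ
  hd-cancel p q 0<p q<0 = begin
    hd p ⁻¹ * hd p + (- hd q) ⁻¹ * hd q       ≡⟨ cong₂ _+_ (⁻¹-inverseˡ 0<p) (neg-neg ((- hd q) ⁻¹) (hd q)) ⟩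
    1ℚ + - ((- hd q) ⁻¹ * - hd q)             ≡⟨ cong (λ e → 1ℚ + - e) (⁻¹-inverseˡ (ℚ.neg-antimono-< q<0)) ⟩
    1ℚ + - 1ℚ                                  ≡⟨ ℚ.+-inverseʳ 1ℚ ⟩
    0ℚ                                         ∎
    where
    open ≡-Reasoning
    neg-neg : ∀ a h → a * h ≡ - (a * - h)
    neg-neg a h = sym (trans (ℚ.neg-distribʳ-* a (- h)) (cong (a *_) (neg-involutive h)))

  combine-derivable : ∀ {L} {p q} → p ∈ₗ L → q ∈ₗ L → Derivable (_∈ₗ L) (lift (combine p q))
  combine-derivable {p = p} {q} p∈L q∈L with 0ℚ ℚ.<? hd p | hd q ℚ.<? 0ℚ
  ... | yes 0<p | yes q<0 = resp (lift-tl (cancel p q) (hd-cancel p q 0<p q<0))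
    (add (scale _ (ℚ.<⇒≤ (⁻¹-pos 0<p)) (hyp p∈L)) (scale _ (ℚ.<⇒≤ (⁻¹-pos (ℚ.neg-antimono-< q<0))) (hyp q∈L)))
  ... | yes _ | no _ = lift-0≤0
  ... | no  _ | _    = lift-0≤0

  drop-derivable : ∀ {L} {r} → r ∈ₗ L → Derivable (_∈ₗ L) (lift (drop r))
  drop-derivable {r = r} r∈L with hd r ℚ.≟ 0ℚ
  ... | yes hd≡0 = resp (lift-tl r hd≡0) (hyp r∈L)
  ... | no  _    = lift-0≤0

  eliminate-derivable : ∀ L {r} → r ∈ₗ eliminate L → Derivable (_∈ₗ L) (lift r)
  eliminate-derivable L r∈ with ∈-++⁻ (List.cartesianProductWith combine L L) r∈
  ... | inj₁ r∈pairs with ∈-cartesianProductWith⁻ combine L L r∈pairs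
  ...   | p , q , p∈L , q∈L , refl = combine-derivable p∈L q∈L
  eliminate-derivable L r∈ | inj₂ r∈drops with ∈-map⁻ drop r∈drops
  ...   | r , r∈L , refl = drop-derivable r∈L

  lift-derivable : {R : Ineq m → Set} {R′ : Ineq (suc m) → Set} →
    (∀ {r} → R r → Derivable R′ (lift r)) → ∀ {r} → Derivable R r → Derivable R′ (lift r)
  lift-derivable R⊆R′ (hyp r∈R)       = R⊆R′ r∈R
  lift-derivable R⊆R′ triv            = lift-0≤0
  lift-derivable R⊆R′ (add d e)       =
    resp ((λ { zero → refl ; (suc k) → refl }) , refl) (add (lift-derivable R⊆R′ d) (lift-derivable R⊆R′ e))
  lift-derivable R⊆R′ (scale q q≥0 d) =
    resp ((λ { zero → ℚ.*-zeroʳ q ; (suc k) → refl }) , refl) (scale q q≥0 (lift-derivable R⊆R′ d))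
  lift-derivable R⊆R′ (resp (a≗a′ , β≡β′) d) =
    resp ((λ { zero → refl ; (suc k) → a≗a′ k }) , β≡β′) (lift-derivable R⊆R′ d)

  combine-cancel : ∀ p q → 0ℚ < hd p → hd q < 0ℚ → combine p q ≡ tl (cancel p q)
  combine-cancel p q 0<p q<0 with 0ℚ ℚ.<? hd p | hd q ℚ.<? 0ℚ
  ... | yes _ | yes _  = refl
  ... | yes _ | no q≮0 = ⊥-elim (q≮0 q<0)
  ... | no 0≮p | _     = ⊥-elim (0≮p 0<p)

  drop-tl : ∀ r → hd r ≡ 0ℚ → drop r ≡ tl r
  drop-tl r hd≡0 with hd r ℚ.≟ 0ℚ
  ... | yes _   = refl
  ... | no hd≢0 = ⊥-elim (hd≢0 hd≡0)

  -- A solution of the eliminated system extends to one of L: the first coordinate is chosen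
  -- between the lower bounds imposed by the rows with negative head and the upper bounds
  -- imposed by those with positive head.
  module Extend (L : List (Ineq (suc m))) (x′ : Vector ℚ m) (x′⊨ : ∀ {r} → r ∈ₗ eliminate L → x′ ⊨ r) where

    rest : Ineq (suc m) → ℚ
    rest r = dot (proj₁ (tl r)) x′

    upper lower : Ineq (suc m) → ℚ
    upper r = hd r ⁻¹ * (proj₂ r - rest r)
    lower r = (- hd r) ⁻¹ * (rest r - proj₂ r)

    Ups Lows : List ℚ
    Ups  = List.map upper (List.filter (λ r → 0ℚ ℚ.<? hd r) L)
    Lows = List.map lower (List.filter (λ r → hd r ℚ.<? 0ℚ) L)

    lower≤upper : ∀ {p q} → p ∈ₗ L → q ∈ₗ L → 0ℚ < hd p → hd q < 0ℚ → lower q ≤ upper p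
    lower≤upper {p} {q} p∈L q∈L 0<p q<0 = begin
      γ * (rest q - proj₂ q)                                     ≡⟨ expand α γ (rest p) (rest q) (proj₂ q) ⟩
      (α * rest p + γ * rest q) - (α * rest p + γ * proj₂ q)     ≤⟨ ℚ.+-monoˡ-≤ _ x′⊨pq ⟩
      (α * proj₂ p + γ * proj₂ q) - (α * rest p + γ * proj₂ q)   ≡⟨ collect α γ (rest p) (proj₂ p) (proj₂ q) ⟩
      α * (proj₂ p - rest p)                                     ∎
      where
      open ℚ.≤-Reasoning
      open ℚ-Solver
      expand : ∀ α γ sp sq βq → γ * (sq - βq) ≡ (α * sp + γ * sq) - (α * sp + γ * βq)
      expand = solve 5 (λ α γ sp sq βq → γ :* (sq :- βq) := (α :* sp :+ γ :* sq) :- (α :* sp :+ γ :* βq)) refl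
      collect : ∀ α γ sp βp βq → (α * βp + γ * βq) - (α * sp + γ * βq) ≡ α * (βp - sp)
      collect = solve 5 (λ α γ sp βp βq → (α :* βp :+ γ :* βq) :- (α :* sp :+ γ :* βq) := α :* (βp :- sp)) refl
      α = hd p ⁻¹
      γ = (- hd q) ⁻¹
      tail-p tail-q : Vector ℚ m
      tail-p = proj₁ (tl p)
      tail-q = proj₁ (tl q)
      x′⊨pq : α * rest p + γ * rest q ≤ α * proj₂ p + γ * proj₂ q
      x′⊨pq = subst (_≤ α * proj₂ p + γ * proj₂ q)
        (trans (dot-+ˡ (λ k → α * tail-p k) (λ k → γ * tail-q k) x′) (cong₂ _+_ (dot-*ˡ α tail-p x′) (dot-*ˡ γ tail-q x′)))
        (subst (x′ ⊨_) (combine-cancel p q 0<p q<0)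
          (x′⊨ (∈-++⁺ˡ (∈-cartesianProductWith⁺ combine p∈L q∈L))))

    Lows≤Ups : ∀ {l u} → l ∈ₗ Lows → u ∈ₗ Ups → l ≤ u
    Lows≤Ups l∈ u∈ with ∈-map∘filter⁻ lower (λ r → hd r ℚ.<? 0ℚ) l∈ | ∈-map∘filter⁻ upper (λ r → 0ℚ ℚ.<? hd r) u∈
    ... | q , q∈L , refl , q<0 | p , p∈L , refl , 0<p = lower≤upper p∈L q∈L 0<p q<0

    x₀ : ℚ
    x₀ = proj₁ (exists-between Lows Ups Lows≤Ups)

    x₀∷x′⊨ : ∀ {r} → r ∈ₗ L → (x₀ ∷ x′) ⊨ r
    x₀∷x′⊨ {r} r∈L with ℚ.<-cmp 0ℚ (hd r)
    ... | tri< 0<r _ _ = upper-bound 0<r (proj₂ (proj₂ (exists-between Lows Ups Lows≤Ups))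
                           (∈-map∘filter⁺ upper (λ r → 0ℚ ℚ.<? hd r) (r , r∈L , refl , 0<r)))
    ... | tri> _ _ r<0 = lower-bound r<0 (proj₁ (proj₂ (exists-between Lows Ups Lows≤Ups))
                           (∈-map∘filter⁺ lower (λ r → hd r ℚ.<? 0ℚ) (r , r∈L , refl , r<0)))
    ... | tri≈ _ 0≡r _ = begin
      hd r * x₀ + rest r     ≡⟨ cong (λ h → h * x₀ + rest r) (sym 0≡r) ⟩
      0ℚ * x₀ + rest r       ≡⟨ cong (_+ rest r) (ℚ.*-zeroˡ x₀) ⟩
      0ℚ + rest r            ≡⟨ ℚ.+-identityˡ (rest r) ⟩
      rest r                 ≤⟨ subst (x′ ⊨_) (drop-tl r (sym 0≡r)) (x′⊨ (∈-++⁺ʳ _ (∈-map⁺ drop r∈L))) ⟩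
      proj₂ r                ∎
      where open ℚ.≤-Reasoning

open FourierMotzkin using (eliminate; eliminate-derivable; lift-derivable; module Extend)

fourier-motzkin : ∀ m (L : List (Ineq m)) → Solvable (_∈ₗ L) ⊎ Refutable (_∈ₗ L)
fourier-motzkin zero L with any? (λ r → proj₂ r ℚ.<? 0ℚ) L
... | yes some<0 with find some<0
...   | r , r∈L , β<0 = inj₂ (proj₂ r , β<0 , resp ((λ ()) , refl) (hyp r∈L))
fourier-motzkin zero L | no none<0 = inj₁ ((λ ()) , λ r∈L → ℚ.≮⇒≥ (λ β<0 → none<0 (lose r∈L β<0)))
fourier-motzkin (suc m) L with fourier-motzkin m (eliminate L)
... | inj₁ (x′ , x′⊨) = inj₁ (x₀ ∷ x′ , x₀∷x′⊨)
  where open Extend L x′ x′⊨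
... | inj₂ (β , β<0 , d) = inj₂ (β , β<0 ,
  resp ((λ { zero → refl ; (suc k) → refl }) , refl) (lift-derivable (eliminate-derivable L) d))

Feasible : (Fin N → Vector ℚ m) → Vector ℚ N → Vector ℚ m → Set
Feasible A c x = ∀ i → dot (A i) x ≤ c i

Combination : (Fin N → Vector ℚ m) → Vector ℚ N → Ineq m → Set
Combination {N} A β (a , b) = Σ[ y ∈ Vector ℚ N ]
  (∀ i → 0ℚ ≤ y i) × (∀ k → a k ≡ sumℚ (λ i → y i * A i k)) × b ≡ sumℚ (λ i → y i * β i)

derivable⇒combination : ∀ (A : Fin N → Vector ℚ m) β {r} →
  Derivable (_∈ₗ List.tabulate (λ i → A i , β i)) r → Combination A β r
derivable⇒combination A β (hyp r∈) with ∈-tabulate⁻ r∈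
... | i , refl = δ i , δ-nonneg i , (λ k → sym (sumℚ-δ i (λ j → A j k))) , sym (sumℚ-δ i β)
derivable⇒combination A β triv =
  (λ _ → 0ℚ) , (λ _ → ℚ.≤-refl) , (λ k → sym (dot-zeroˡ (λ i → A i k))) , sym (dot-zeroˡ β)
derivable⇒combination A β (add d e)
  with derivable⇒combination A β d | derivable⇒combination A β e
... | y , y≥0 , a≡yA , b≡yβ | y′ , y′≥0 , a′≡y′A , b′≡y′β =
  (λ i → y i + y′ i) , (λ i → +-nonneg (y≥0 i) (y′≥0 i)) ,
  (λ k → trans (cong₂ _+_ (a≡yA k) (a′≡y′A k)) (sym (dot-+ˡ y y′ (λ i → A i k)))) ,
  trans (cong₂ _+_ b≡yβ b′≡y′β) (sym (dot-+ˡ y y′ β))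
derivable⇒combination A β (scale q q≥0 d) with derivable⇒combination A β d
... | y , y≥0 , a≡yA , b≡yβ =
  (λ i → q * y i) , (λ i → *-nonneg q≥0 (y≥0 i)) ,
  (λ k → trans (cong (q *_) (a≡yA k)) (sym (dot-*ˡ q y (λ i → A i k)))) ,
  trans (cong (q *_) b≡yβ) (sym (dot-*ˡ q y β))
derivable⇒combination A β (resp (a≗a′ , b≡b′) d) with derivable⇒combination A β d
... | y , y≥0 , a≡yA , b≡yβ = y , y≥0 , (λ k → trans (sym (a≗a′ k)) (a≡yA k)) , trans (sym b≡b′) b≡yβ

farkas : ∀ (A : Fin N → Vector ℚ m) (β : Vector ℚ N) →
  (Σ[ x ∈ Vector ℚ m ] Feasible A β x) ⊎
  (Σ[ y ∈ Vector ℚ N ] (∀ i → 0ℚ ≤ y i) × (∀ k → sumℚ (λ i → y i * A i k) ≡ 0ℚ) × sumℚ (λ i → y i * β i) < 0ℚ)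
farkas {m = m} A β with fourier-motzkin m (List.tabulate (λ i → A i , β i))
... | inj₁ (x , x⊨) = inj₁ (x , λ i → x⊨ (∈-tabulate⁺ i))
... | inj₂ (b , b<0 , d) with derivable⇒combination A β d
...   | y , y≥0 , 0≡yA , b≡yβ = inj₂ (y , y≥0 , (λ k → sym (0≡yA k)) , subst (_< 0ℚ) b≡yβ b<0)

Separated : Config m n → Subset n → Vector ℚ m → Set
Separated {m} B S b = Σ[ d ∈ Vector ℚ m ] (∀ i → i ∈ S → dotℚ (B i) d ≤ 0ℚ) × 0ℚ < dot b d

indicator : Subset n → Vector ℚ n
indicator S i with i ∈? S
... | yes _ = 1ℚ
... | no  _ = 0ℚ

indicator-∈ : ∀ (S : Subset n) {i} → i ∈ S → indicator S i ≡ 1ℚ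
indicator-∈ S {i} i∈S with i ∈? S
... | yes _   = refl
... | no  i∉S = ⊥-elim (i∉S i∈S)

indicator-∉ : ∀ (S : Subset n) {i} → i ∉ S → indicator S i ≡ 0ℚ
indicator-∉ S {i} i∉S with i ∈? S
... | yes i∈S = ⊥-elim (i∉S i∈S)
... | no  _   = refl

indicator-nonneg : ∀ (S : Subset n) i → 0ℚ ≤ indicator S i
indicator-nonneg S i with i ∈? S
... | yes _ = ℚ.nonNegative⁻¹ 1ℚ
... | no  _ = ℚ.≤-refl

-- Farkas' lemma for  -b·d ≤ -1,  [i ∈ S] bᵢ·d ≤ 0: the rows outside S are zeroed, so a
-- certificate of infeasibility only combines the bᵢ with i ∈ S.
module _ (B : Config m n) (S : Subset n) (b : Vector ℚ m) where

  private
    rows : Fin (suc n) → Vector ℚ m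
    rows = (λ k → - b k) ∷ (λ i k → indicator S i * toℚ (B i k))

    rhs : Vector ℚ (suc n)
    rhs = - 1ℚ ∷ (λ _ → 0ℚ)

    separated : Σ[ d ∈ Vector ℚ m ] Feasible rows rhs d → Separated B S b
    separated (d , d-feasible) = d , Bd≤0 , 0<bd
      where
      Bd≤0 : ∀ i → i ∈ S → dotℚ (B i) d ≤ 0ℚ
      Bd≤0 i i∈S = subst (_≤ 0ℚ)
        (trans (dot-*ˡ (indicator S i) (λ k → toℚ (B i k)) d)
               (trans (cong (_* dotℚ (B i) d) (indicator-∈ S i∈S)) (ℚ.*-identityˡ _)))
        (d-feasible (suc i))
      0<bd : 0ℚ < dot b d
      0<bd = ℚ.<-≤-trans (ℚ.positive⁻¹ 1ℚ)
        (neg-cancel-≤ (subst (_≤ - 1ℚ) (dot-negˡ b d) (d-feasible zero)))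

    in-cone : Σ[ y ∈ Vector ℚ (suc n) ] (∀ i → 0ℚ ≤ y i) × (∀ k → sumℚ (λ i → y i * rows i k) ≡ 0ℚ) ×
                sumℚ (λ i → y i * rhs i) < 0ℚ → InCone B S b
    in-cone (y , y≥0 , yA≡0 , yβ<0) = λ′ , λ′≥0 , λ′∉S , b≡λ′B
      where
      open ≡-Reasoning
      open ℚ-Solver
      t = y zero
      0<t : 0ℚ < t
      0<t = neg-cancel-< (subst (_< 0ℚ) yβ≡-t yβ<0)
        where
        yβ≡-t : t * - 1ℚ + sumℚ (λ i → y (suc i) * 0ℚ) ≡ - t
        yβ≡-t = trans (cong (t * - 1ℚ +_) (trans (sumℚ-cong (λ i → ℚ.*-zeroʳ (y (suc i)))) (sumℚ-zero {n})))
          (solve 1 (λ t → t :* (:- con 1ℚ) :+ con 0ℚ := :- t) refl t)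
      λ′ : Fin n → ℚ
      λ′ i = t ⁻¹ * (y (suc i) * indicator S i)
      λ′≥0 : ∀ i → 0ℚ ≤ λ′ i
      λ′≥0 i = *-nonneg (ℚ.<⇒≤ (⁻¹-pos 0<t)) (*-nonneg (y≥0 (suc i)) (indicator-nonneg S i))
      λ′∉S : ∀ i → i ∉ S → λ′ i ≡ 0ℚ
      λ′∉S i i∉S = begin
        t ⁻¹ * (y (suc i) * indicator S i)   ≡⟨ cong (λ e → t ⁻¹ * (y (suc i) * e)) (indicator-∉ S i∉S) ⟩
        t ⁻¹ * (y (suc i) * 0ℚ)              ≡⟨ solve 2 (λ a b → a :* (b :* con 0ℚ) := con 0ℚ) refl (t ⁻¹) (y (suc i)) ⟩
        0ℚ                                   ∎
      b≡λ′B : ∀ k → b k ≡ sumℚ (λ i → λ′ i * toℚ (B i k))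
      b≡λ′B k = begin
        b k                      ≡⟨ ℚ.*-identityˡ (b k) ⟨
        1ℚ * b k                 ≡⟨ cong (_* b k) (⁻¹-inverseˡ 0<t) ⟨
        t ⁻¹ * t * b k           ≡⟨ ℚ.*-assoc (t ⁻¹) t (b k) ⟩
        t ⁻¹ * (t * b k)         ≡⟨ cong (t ⁻¹ *_) tb≡σ ⟩
        t ⁻¹ * σ                 ≡⟨ *-distribˡ-sumℚ (t ⁻¹) (λ i → y (suc i) * (indicator S i * toℚ (B i k))) ⟩
        sumℚ (λ i → t ⁻¹ * (y (suc i) * (indicator S i * toℚ (B i k))))
                                 ≡⟨ sumℚ-cong (λ i → regroup (t ⁻¹) (y (suc i)) (indicator S i) (toℚ (B i k))) ⟩
        sumℚ (λ i → λ′ i * toℚ (B i k)) ∎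
        where
        σ = sumℚ (λ i → y (suc i) * (indicator S i * toℚ (B i k)))
        regroup : ∀ a y g c → a * (y * (g * c)) ≡ a * (y * g) * c
        regroup = solve 4 (λ a y g c → a :* (y :* (g :* c)) := a :* (y :* g) :* c) refl
        tb≡σ : t * b k ≡ σ
        tb≡σ = begin
          t * b k                 ≡⟨ solve 3 (λ t b s → t :* b := s :- (t :* (:- b) :+ s)) refl t (b k) σ ⟩
          σ - (t * - b k + σ)     ≡⟨ cong (λ e → σ - e) (yA≡0 k) ⟩
          σ - 0ℚ                  ≡⟨ solve 1 (λ s → s :- con 0ℚ := s) refl σ ⟩
          σ                       ∎

  cone-or-separated : InCone B S b ⊎ Separated B S b
  cone-or-separated = [ inj₂ ∘ separated , inj₁ ∘ in-cone ]′ (farkas rows rhs)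

-- Linear programming duality

IsDualFeasible : (Fin n → Vector ℚ m) → Vector ℚ m → Vector ℚ n → Set
IsDualFeasible A w y = (∀ i → 0ℚ ≤ y i) × (∀ k → w k ≡ sumℚ (λ i → y i * A i k))

weak-duality : ∀ (A : Fin n → Vector ℚ m) {c w x y} →
  Feasible A c x → IsDualFeasible A w y → dot w x ≤ sumℚ (λ i → y i * c i)
weak-duality A {c} {w} {x} {y} Ax≤c (y≥0 , w≡yA) = begin
  dot w x                           ≡⟨ dot-lincomb A y x w≡yA ⟩
  sumℚ (λ i → y i * dot (A i) x)    ≤⟨ sumℚ-mono-≤ (λ i → *-monoˡ-≤-nonneg (y≥0 i) (Ax≤c i)) ⟩
  sumℚ (λ i → y i * c i)            ∎
  where open ℚ.≤-Reasoning

improving-ray⇒unbounded : ∀ (A : Fin n → Vector ℚ m) {c w x₀ d M} → Feasible A c x₀ →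
  (∀ i → dot (A i) d ≤ 0ℚ) → 0ℚ < dot w d → ¬ (∀ x → Feasible A c x → dot w x ≤ M)
improving-ray⇒unbounded A {c} {w} {x₀} {d} {M} x₀-feasible Ad≤0 0<wd bounded =
  ℚ.<-irrefl refl (ℚ.<-≤-trans M<wx (bounded x x-feasible))
  where
  open ℚ-Solver
  gap = M - dot w x₀ + 1ℚ
  s = gap * dot w d ⁻¹
  0<gap : 0ℚ < gap
  0<gap = begin-strict
    0ℚ                       ≡⟨ ℚ.+-inverseʳ (dot w x₀) ⟨
    dot w x₀ - dot w x₀      ≤⟨ ℚ.+-monoˡ-≤ (- dot w x₀) (bounded x₀ x₀-feasible) ⟩
    M - dot w x₀             <⟨ p<p+1 (M - dot w x₀) ⟩
    gap                      ∎
    where open ℚ.≤-Reasoning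
  0≤s : 0ℚ ≤ s
  0≤s = *-nonneg (ℚ.<⇒≤ 0<gap) (ℚ.<⇒≤ (⁻¹-pos 0<wd))
  x : Vector ℚ _
  x k = x₀ k + s * d k
  x-feasible : Feasible A c x
  x-feasible i = begin
    dot (A i) x                           ≡⟨ dot-ray (A i) x₀ d s ⟩
    dot (A i) x₀ + s * dot (A i) d        ≤⟨ ℚ.+-mono-≤ (x₀-feasible i) (*-monoˡ-≤-nonneg 0≤s (Ad≤0 i)) ⟩
    c i + s * 0ℚ                          ≡⟨ solve 2 (λ c s → c :+ s :* con 0ℚ := c) refl (c i) s ⟩
    c i                                   ∎
    where open ℚ.≤-Reasoning
  M<wx : M < dot w x
  M<wx = subst (M <_) (sym (begin
    dot w x                               ≡⟨ dot-ray w x₀ d s ⟩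
    dot w x₀ + gap * dot w d ⁻¹ * dot w d ≡⟨ cong (dot w x₀ +_) rescale ⟩
    dot w x₀ + gap                        ≡⟨ solve 2 (λ M wx → wx :+ (M :- wx :+ con 1ℚ) := M :+ con 1ℚ) refl M (dot w x₀) ⟩
    M + 1ℚ                                ∎))
    (p<p+1 M)
    where
    open ≡-Reasoning
    rescale : gap * dot w d ⁻¹ * dot w d ≡ gap
    rescale = trans (ℚ.*-assoc gap _ _) (trans (cong (gap *_) (⁻¹-inverseˡ 0<wd)) (ℚ.*-identityʳ gap))

-- t > 0 contradicts weak duality scaled by t; t = 0 yields an improving ray.
no-primal-dual-certificate : ∀ (A : Fin n → Vector ℚ m) {c w x₀ M u t d} →
  Feasible A c x₀ → (∀ x → Feasible A c x → dot w x ≤ M) →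
  (∀ i → 0ℚ ≤ u i) → 0ℚ ≤ t → (∀ k → sumℚ (λ i → u i * A i k) ≡ t * w k) →
  (∀ j → dot (A j) d ≤ t * c j) → sumℚ (λ i → u i * c i) < dot w d → ⊥
no-primal-dual-certificate {n} A {c} {w} {x₀} {M} {u} {t} {d} x₀-feasible bounded u≥0 t≥0 uA≡tw Ad≤tc uc<wd
  with ℚ.<-cmp 0ℚ t
... | tri> _ _ t<0 = ℚ.<-irrefl refl (ℚ.<-≤-trans t<0 t≥0)
... | tri< 0<t _ _ = ℚ.<-irrefl refl (ℚ.<-≤-trans uc<wd wd≤uc)
  where
  wd≤uc : dot w d ≤ sumℚ (λ i → u i * c i)
  wd≤uc = ℚ.*-cancelˡ-≤-pos t {{ℚ.positive 0<t}} (begin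
    t * dot w d                        ≡⟨ dot-*ˡ t w d ⟨
    dot (λ k → t * w k) d              ≡⟨ dot-lincomb A u d (λ k → sym (uA≡tw k)) ⟩
    sumℚ (λ i → u i * dot (A i) d)     ≤⟨ sumℚ-mono-≤ (λ i → *-monoˡ-≤-nonneg (u≥0 i) (Ad≤tc i)) ⟩
    sumℚ (λ i → u i * (t * c i))       ≡⟨ sumℚ-cong (λ i → solve 3 (λ u t c → u :* (t :* c) := t :* (u :* c)) refl (u i) t (c i)) ⟩
    sumℚ (λ i → t * (u i * c i))       ≡⟨ *-distribˡ-sumℚ t (λ i → u i * c i) ⟨
    t * sumℚ (λ i → u i * c i)         ∎)
    where
    open ℚ.≤-Reasoning
    open ℚ-Solver
... | tri≈ _ refl _ = improving-ray⇒unbounded A {w = w} x₀-feasible Ad≤0 0<wd bounded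
  where
  open ℚ.≤-Reasoning
  Ad≤0 : ∀ j → dot (A j) d ≤ 0ℚ
  Ad≤0 j = subst (dot (A j) d ≤_) (ℚ.*-zeroˡ (c j)) (Ad≤tc j)
  0<wd : 0ℚ < dot w d
  0<wd = begin-strict
    0ℚ                                  ≡⟨ dot-zeroˡ x₀ ⟨
    dot (λ _ → 0ℚ) x₀                   ≡⟨ dot-lincomb A u x₀ (λ k → trans (sym (ℚ.*-zeroˡ (w k))) (sym (uA≡tw k))) ⟩
    sumℚ (λ i → u i * dot (A i) x₀)     ≤⟨ sumℚ-mono-≤ (λ i → *-monoˡ-≤-nonneg (u≥0 i) (x₀-feasible i)) ⟩
    sumℚ (λ i → u i * c i)              <⟨ uc<wd ⟩
    dot w d                             ∎

record Ineq₂ (m n : ℕ) : Set where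
  constructor ineq₂
  field
    coeffˣ : Vector ℚ m
    coeffʸ : Vector ℚ n
    bound  : ℚ

open Ineq₂

_⊨₂_ : Vector ℚ m × Vector ℚ n → Ineq₂ m n → Set
(x , y) ⊨₂ r = dot (coeffˣ r) x + dot (coeffʸ r) y ≤ bound r

farkas₂ : ∀ (S : Fin N → Ineq₂ m n) →
  (Σ[ z ∈ Vector ℚ m × Vector ℚ n ] ∀ i → z ⊨₂ S i) ⊎
  (Σ[ l ∈ Vector ℚ N ] (∀ i → 0ℚ ≤ l i) ×
     (∀ k → sumℚ (λ i → l i * coeffˣ (S i) k) ≡ 0ℚ) ×
     (∀ j → sumℚ (λ i → l i * coeffʸ (S i) j) ≡ 0ℚ) ×
     sumℚ (λ i → l i * bound (S i)) < 0ℚ)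
farkas₂ {m = m} {n} S with farkas (λ i → coeffˣ (S i) ++ coeffʸ (S i)) (λ i → bound (S i))
... | inj₁ (z , z-feasible) = inj₁ (((λ k → z (k ↑ˡ n)) , (λ j → z (m ↑ʳ j))) ,
  λ i → subst (_≤ bound (S i)) (dot-++ (coeffˣ (S i)) (coeffʸ (S i)) z) (z-feasible i))
... | inj₂ (l , l≥0 , lS≡0 , lβ<0) = inj₂ (l , l≥0 ,
  (λ k → trans (sumℚ-cong (λ i → cong (l i *_) (sym (lookup-++ˡ (coeffˣ (S i)) (coeffʸ (S i)) k)))) (lS≡0 (k ↑ˡ n))) ,
  (λ j → trans (sumℚ-cong (λ i → cong (l i *_) (sym (lookup-++ʳ (coeffˣ (S i)) (coeffʸ (S i)) j)))) (lS≡0 (m ↑ʳ j))) ,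
  lβ<0)

sumℚ-*-++ : ∀ {A : Set} (F : A → ℚ) (l : Vector ℚ (m ℕ.+ n)) (f : Fin m → A) (g : Fin n → A) →
  sumℚ (λ ι → l ι * F ((f ++ g) ι)) ≡ sumℚ (λ i → l (i ↑ˡ n) * F (f i)) + sumℚ (λ j → l (m ↑ʳ j) * F (g j))
sumℚ-*-++ {m} F l f g = trans (sumℚ-↑ m (λ ι → l ι * F ((f ++ g) ι))) (cong₂ _+_
  (sumℚ-cong (λ i → cong (λ r → l (i ↑ˡ _) * F r) (lookup-++ˡ f g i)))
  (sumℚ-cong (λ j → cong (λ r → l (m ↑ʳ j) * F r) (lookup-++ʳ f g j))))

dot-difference : ∀ (a q p : Vector ℚ n) →
  dot a (λ k → q k - p k) ≡ sumℚ (λ k → q k * a k) - sumℚ (λ k → p k * a k)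
dot-difference a q p = begin
  sumℚ (λ k → a k * (q k - p k))                           ≡⟨ sumℚ-cong (λ k → distrib (a k) (q k) (p k)) ⟩
  sumℚ (λ k → q k * a k + p k * - a k)                      ≡⟨ sumℚ-+ (λ k → q k * a k) (λ k → p k * - a k) ⟩
  sumℚ (λ k → q k * a k) + sumℚ (λ k → p k * - a k)         ≡⟨ cong (sumℚ (λ k → q k * a k) +_) (dot-negʳ p a) ⟩
  sumℚ (λ k → q k * a k) - sumℚ (λ k → p k * a k)           ∎
  where
  open ≡-Reasoning
  open ℚ-Solver
  distrib : ∀ a q p → a * (q - p) ≡ q * a + p * - a
  distrib = solve 3 (λ a q p → a :* (q :- p) := q :* a :+ p :* (:- a)) refl

module _ (A : Fin n → Vector ℚ m) (c : Vector ℚ n) (w : Vector ℚ m) where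

  private
    0⃗ : ∀ {k} → Vector ℚ k
    0⃗ _ = 0ℚ

    col : Fin m → Vector ℚ n
    col k i = A i k

    value : Ineq₂ m n
    value = ineq₂ (λ k → - w k) c 0ℚ

    primal : Fin n → Ineq₂ m n
    primal i = ineq₂ (A i) 0⃗ (c i)

    sign : Fin n → Ineq₂ m n
    sign j = ineq₂ 0⃗ (λ i → - δ j i) 0ℚ

    dual dual⁻ : Fin m → Ineq₂ m n
    dual  k = ineq₂ 0⃗ (col k) (w k)
    dual⁻ k = ineq₂ 0⃗ (λ i → - col k i) (- w k)

    -- A x ≤ c,  y ≥ 0,  Aᵀ y = w,  c·y ≤ w·x  in the variables (x, y).
    system : Fin (suc (n ℕ.+ (n ℕ.+ (m ℕ.+ m)))) → Ineq₂ m n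
    system = value ∷ (primal ++ (sign ++ (dual ++ dual⁻)))

    module Solution (x : Vector ℚ m) (y : Vector ℚ n) (sat : ∀ ι → (x , y) ⊨₂ system ι) where

      ⊨₂-ʸ : ∀ b {β} → (x , y) ⊨₂ ineq₂ 0⃗ b β → dot b y ≤ β
      ⊨₂-ʸ b {β} = subst (_≤ β) (trans (cong (_+ dot b y) (dot-zeroˡ x)) (ℚ.+-identityˡ (dot b y)))

      x-feasible : Feasible A c x
      x-feasible i = subst (_≤ c i) (trans (cong (dot (A i) x +_) (dot-zeroˡ y)) (ℚ.+-identityʳ _))
        (subst ((x , y) ⊨₂_) (lookup-++ˡ primal _ i) (sat (suc (i ↑ˡ _))))

      y-dual-feasible : IsDualFeasible A w y
      y-dual-feasible = y≥0 , w≡yA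
        where
        y≥0 : ∀ j → 0ℚ ≤ y j
        y≥0 j = neg-cancel-≤ (subst (_≤ 0ℚ) (trans (dot-negˡ (δ j) y) (cong -_ (sumℚ-δ j y)))
          (⊨₂-ʸ (λ i → - δ j i) (subst ((x , y) ⊨₂_) (trans (lookup-++ʳ primal _ (j ↑ˡ _)) (lookup-++ˡ sign _ j))
            (sat (suc (n ↑ʳ (j ↑ˡ _)))))))
        at-dual : ∀ k → system (suc (n ↑ʳ (n ↑ʳ (k ↑ˡ m)))) ≡ dual k
        at-dual k = trans (lookup-++ʳ primal _ _) (trans (lookup-++ʳ sign _ _) (lookup-++ˡ dual dual⁻ k))
        at-dual⁻ : ∀ k → system (suc (n ↑ʳ (n ↑ʳ (m ↑ʳ k)))) ≡ dual⁻ k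
        at-dual⁻ k = trans (lookup-++ʳ primal _ _) (trans (lookup-++ʳ sign _ _) (lookup-++ʳ dual dual⁻ k))
        w≡yA : ∀ k → w k ≡ sumℚ (λ i → y i * A i k)
        w≡yA k = trans (ℚ.≤-antisym
          (neg-cancel-≤ (subst (_≤ - w k) (dot-negˡ (col k) y)
            (⊨₂-ʸ (λ i → - col k i) (subst ((x , y) ⊨₂_) (at-dual⁻ k) (sat (suc (n ↑ʳ (n ↑ʳ (m ↑ʳ k)))))))))
          (⊨₂-ʸ (col k) (subst ((x , y) ⊨₂_) (at-dual k) (sat (suc (n ↑ʳ (n ↑ʳ (k ↑ˡ m))))))))
          (dot-comm (col k) y)

      no-gap : sumℚ (λ i → y i * c i) ≤ dot w x
      no-gap = begin
        sumℚ (λ i → y i * c i)                   ≡⟨ dot-comm y c ⟩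
        dot c y                                   ≡⟨ solve 2 (λ a b → b := a :+ (:- a :+ b)) refl (dot w x) (dot c y) ⟩
        dot w x + (- dot w x + dot c y)           ≤⟨ ℚ.+-monoʳ-≤ (dot w x) (subst (λ e → e + dot c y ≤ 0ℚ) (dot-negˡ w x) (sat zero)) ⟩
        dot w x + 0ℚ                              ≡⟨ ℚ.+-identityʳ (dot w x) ⟩
        dot w x                                   ∎
        where
        open ℚ.≤-Reasoning
        open ℚ-Solver

    module Certificate (l : Vector ℚ (suc (n ℕ.+ (n ℕ.+ (m ℕ.+ m))))) (l≥0 : ∀ ι → 0ℚ ≤ l ι)
      (lˣ≡0 : ∀ k → sumℚ (λ ι → l ι * coeffˣ (system ι) k) ≡ 0ℚ)
      (lʸ≡0 : ∀ j → sumℚ (λ ι → l ι * coeffʸ (system ι) j) ≡ 0ℚ)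
      (lβ<0 : sumℚ (λ ι → l ι * bound (system ι)) < 0ℚ) where

      t : ℚ
      t = l zero

      u v : Vector ℚ n
      u i = l (suc (i ↑ˡ _))
      v j = l (suc (n ↑ʳ (j ↑ˡ _)))

      p q d : Vector ℚ m
      p k = l (suc (n ↑ʳ (n ↑ʳ (k ↑ˡ m))))
      q k = l (suc (n ↑ʳ (n ↑ʳ (m ↑ʳ k))))
      d k = q k - p k

      blocks : ∀ (F : Ineq₂ m n → ℚ) → sumℚ (λ ι → l ι * F (system ι)) ≡
        t * F value + (sumℚ (λ i → u i * F (primal i)) + (sumℚ (λ j → v j * F (sign j)) +
          (sumℚ (λ k → p k * F (dual k)) + sumℚ (λ k → q k * F (dual⁻ k)))))
      blocks F = cong (t * F value +_)
        (trans (sumℚ-*-++ F (λ ι → l (suc ι)) primal (sign ++ (dual ++ dual⁻)))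
        (cong (sumℚ (λ i → u i * F (primal i)) +_)
        (trans (sumℚ-*-++ F (λ ι → l (suc (n ↑ʳ ι))) sign (dual ++ dual⁻))
        (cong (sumℚ (λ j → v j * F (sign j)) +_)
          (sumℚ-*-++ F (λ ι → l (suc (n ↑ʳ (n ↑ʳ ι)))) dual dual⁻)))))

      uA≡tw : ∀ k → sumℚ (λ i → u i * A i k) ≡ t * w k
      uA≡tw k = begin
        U                                                ≡⟨ isolate U t (w k) ⟩
        (t * - w k + (U + (0ℚ + (0ℚ + 0ℚ)))) + t * w k   ≡⟨ cong (_+ t * w k) x-coordinate ⟩
        0ℚ + t * w k                                     ≡⟨ ℚ.+-identityˡ (t * w k) ⟩
        t * w k                                          ∎
        where
        open ≡-Reasoning
        open ℚ-Solver
        U = sumℚ (λ i → u i * A i k)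
        isolate : ∀ U t w → U ≡ (t * - w + (U + (0ℚ + (0ℚ + 0ℚ)))) + t * w
        isolate = solve 3 (λ U t w → U := (t :* (:- w) :+ (U :+ (con 0ℚ :+ (con 0ℚ :+ con 0ℚ)))) :+ t :* w) refl
        x-coordinate : t * - w k + (U + (0ℚ + (0ℚ + 0ℚ))) ≡ 0ℚ
        x-coordinate = trans
          (cong (λ e → t * - w k + (U + e)) (sym (cong₂ _+_ (dot-zeroʳ v) (cong₂ _+_ (dot-zeroʳ p) (dot-zeroʳ q)))))
          (trans (sym (blocks (λ r → coeffˣ r k))) (lˣ≡0 k))

      Ad≤tc : ∀ j → dot (A j) d ≤ t * c j
      Ad≤tc j = begin
        dot (A j) d                                      ≡⟨ dot-difference (A j) q p ⟩
        Q - P                                            ≡⟨ isolate (t * c j) V P Q ⟩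
        t * c j - V - (t * c j + (0ℚ + (- V + (P + - Q)))) ≡⟨ cong (λ e → t * c j - V - e) y-coordinate ⟩
        t * c j - V - 0ℚ                                 ≡⟨ ℚ.+-identityʳ (t * c j - V) ⟩
        t * c j + - V                                    ≤⟨ ℚ.+-monoʳ-≤ (t * c j) (ℚ.neg-antimono-≤ 0≤V) ⟩
        t * c j + 0ℚ                                     ≡⟨ ℚ.+-identityʳ (t * c j) ⟩
        t * c j                                          ∎
        where
        open ℚ.≤-Reasoning
        open ℚ-Solver
        V = sumℚ (λ i → v i * δ i j)
        P = sumℚ (λ k → p k * A j k)
        Q = sumℚ (λ k → q k * A j k)
        isolate : ∀ tc V P Q → Q - P ≡ tc - V - (tc + (0ℚ + (- V + (P + - Q))))
        isolate = solve 4 (λ tc V P Q → Q :- P := tc :- V :- (tc :+ (con 0ℚ :+ (:- V :+ (P :+ (:- Q)))))) refl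
        0≤V : 0ℚ ≤ V
        0≤V = sumℚ-nonneg (λ i → *-nonneg (l≥0 _) (δ-nonneg i j))
        y-coordinate : t * c j + (0ℚ + (- V + (P + - Q))) ≡ 0ℚ
        y-coordinate = trans
          (cong (t * c j +_) (sym (cong₂ _+_ (dot-zeroʳ u)
            (cong₂ _+_ (dot-negʳ v (λ i → δ i j)) (cong (P +_) (dot-negʳ q (λ k → A j k)))))))
          (trans (sym (blocks (λ r → coeffʸ r j))) (lʸ≡0 j))

      uc<wd : sumℚ (λ i → u i * c i) < dot w d
      uc<wd = begin-strict
        C                                                ≡⟨ isolate t C P Q ⟩
        (t * 0ℚ + (C + (0ℚ + (P + - Q)))) + (Q - P)      <⟨ ℚ.+-monoˡ-< (Q - P) rhs<0 ⟩
        0ℚ + (Q - P)                                     ≡⟨ ℚ.+-identityˡ (Q - P) ⟩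
        Q - P                                            ≡⟨ dot-difference w q p ⟨
        dot w d                                          ∎
        where
        open ℚ.≤-Reasoning
        open ℚ-Solver
        C = sumℚ (λ i → u i * c i)
        P = sumℚ (λ k → p k * w k)
        Q = sumℚ (λ k → q k * w k)
        isolate : ∀ t C P Q → C ≡ (t * 0ℚ + (C + (0ℚ + (P + - Q)))) + (Q - P)
        isolate = solve 4 (λ t C P Q → C := (t :* con 0ℚ :+ (C :+ (con 0ℚ :+ (P :+ (:- Q))))) :+ (Q :- P)) refl
        rhs<0 : t * 0ℚ + (C + (0ℚ + (P + - Q))) < 0ℚ
        rhs<0 = subst (_< 0ℚ)
          (trans (blocks bound) (cong (λ e → t * 0ℚ + (C + e)) (cong₂ _+_ (dot-zeroʳ v) (cong (P +_) (dot-negʳ q w)))))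
          lβ<0

  strong-duality : ∀ {x₀ M} → Feasible A c x₀ → (∀ x → Feasible A c x → dot w x ≤ M) →
    Σ[ x ∈ Vector ℚ m ] Σ[ y ∈ Vector ℚ n ]
      Feasible A c x × IsDualFeasible A w y × sumℚ (λ i → y i * c i) ≤ dot w x
  strong-duality x₀-feasible bounded with farkas₂ system
  ... | inj₁ ((x , y) , sat) = x , y , x-feasible , y-dual-feasible , no-gap
    where open Solution x y sat
  ... | inj₂ (l , l≥0 , lˣ≡0 , lʸ≡0 , lβ<0) =
    ⊥-elim (no-primal-dual-certificate A x₀-feasible bounded (λ i → l≥0 _) (l≥0 zero) uA≡tw Ad≤tc uc<wd)
    where open Certificate l l≥0 lˣ≡0 lʸ≡0 lβ<0

complementary-slackness : ∀ (A : Fin n → Vector ℚ m) {c w x y} →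
  Feasible A c x → IsDualFeasible A w y → sumℚ (λ i → y i * c i) ≤ dot w x →
  ∀ i → dot (A i) x ≢ c i → y i ≡ 0ℚ
complementary-slackness A {c} {w} {x} {y} Ax≤c (y≥0 , w≡yA) yc≤wx i Aᵢx≢cᵢ =
  *≡0⇒≡0 (sumℚ≤0⇒≡0 (λ i → *-nonneg (y≥0 i) (slack≥0 i)) Σslack≤0 i) slack>0
  where
  slack : Vector ℚ _
  slack i = c i - dot (A i) x
  slack≥0 : ∀ i → 0ℚ ≤ slack i
  slack≥0 i = subst (_≤ slack i) (ℚ.+-inverseʳ (dot (A i) x)) (ℚ.+-monoˡ-≤ (- dot (A i) x) (Ax≤c i))
  slack>0 : 0ℚ < slack i
  slack>0 = subst (_< slack i) (ℚ.+-inverseʳ (dot (A i) x)) (ℚ.+-monoˡ-< (- dot (A i) x) (≤∧≢⇒< (Ax≤c i) Aᵢx≢cᵢ))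
  Σslack≤0 : sumℚ (λ i → y i * slack i) ≤ 0ℚ
  Σslack≤0 = begin
    sumℚ (λ i → y i * slack i)                                   ≡⟨ sumℚ-cong (λ i → distrib (y i) (c i) (dot (A i) x)) ⟩
    sumℚ (λ i → y i * c i + - (y i * dot (A i) x))               ≡⟨ sumℚ-+ (λ i → y i * c i) (λ i → - (y i * dot (A i) x)) ⟩
    sumℚ (λ i → y i * c i) + sumℚ (λ i → - (y i * dot (A i) x))  ≡⟨ cong (sumℚ (λ i → y i * c i) +_) (neg-sumℚ (λ i → y i * dot (A i) x)) ⟨
    sumℚ (λ i → y i * c i) - sumℚ (λ i → y i * dot (A i) x)      ≡⟨ cong (λ e → sumℚ (λ i → y i * c i) - e) (dot-lincomb A y x w≡yA) ⟨
    sumℚ (λ i → y i * c i) - dot w x                             ≤⟨ ℚ.+-monoˡ-≤ (- dot w x) yc≤wx ⟩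
    dot w x - dot w x                                            ≡⟨ ℚ.+-inverseʳ (dot w x) ⟩
    0ℚ                                                           ∎
    where
    open ℚ.≤-Reasoning
    open ℚ-Solver
    distrib : ∀ y c a → y * (c - a) ≡ y * c + - (y * a)
    distrib = solve 3 (λ y c a → y :* (c :- a) := y :* c :+ (:- (y :* a))) refl

select : {P : Fin n → Set} → (∀ i → Dec (P i)) → Subset n
select {zero}  P? = Vec.[]
select {suc n} P? with P? zero
... | yes _ = inside Vec.∷ select (λ i → P? (suc i))
... | no  _ = outside Vec.∷ select (λ i → P? (suc i))

∈-select⁻ : {P : Fin n → Set} (P? : ∀ i → Dec (P i)) {i : Fin n} → i ∈ select P? → P i
∈-select⁻ {suc n} P? {i} i∈ with P? zero | i | i∈
... | yes p | zero  | Vec.here        = p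
... | yes _ | suc i | Vec.there i∈′   = ∈-select⁻ (λ i → P? (suc i)) i∈′
... | no  _ | suc i | Vec.there i∈′   = ∈-select⁻ (λ i → P? (suc i)) i∈′

∈-select⁺ : {P : Fin n → Set} (P? : ∀ i → Dec (P i)) {i : Fin n} → P i → i ∈ select P?
∈-select⁺ {suc n} P? {zero} p with P? zero
... | yes _  = Vec.here
... | no ¬p  = ⊥-elim (¬p p)
∈-select⁺ {suc n} P? {suc i} p with P? zero
... | yes _ = Vec.there (∈-select⁺ (λ i → P? (suc i)) p)
... | no  _ = Vec.there (∈-select⁺ (λ i → P? (suc i)) p)

-- Supernormality makes tight systems totally dual integral

toℚ-lincomb : ∀ (μ : Vector ℤ n) (B : Config m n) {z : ℤ} k →
  z ≡ sumℤ (λ j → μ j ℤ.* B j k) → toℚ z ≡ sumℚ (λ j → toℚ (μ j) * toℚ (B j k))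
toℚ-lincomb μ B k z≡μB = trans (cong toℚ z≡μB)
  (trans (toℚ-sumℤ (λ j → μ j ℤ.* B j k)) (sumℚ-cong (λ j → toℚ-* (μ j) (B j k))))

toℚ-*-cong-≢0 : ∀ k → (k ≢ 0 → a ≡ b) → toℚ (ℤ.+ k) * a ≡ toℚ (ℤ.+ k) * b
toℚ-*-cong-≢0 {a} {b} zero    _   = trans (ℚ.*-zeroˡ a) (sym (ℚ.*-zeroˡ b))
toℚ-*-cong-≢0         (suc k) a≡b = cong (toℚ (ℤ.+ suc k) *_) (a≡b (λ ()))

module _ (B : Config m n) (c : Fin n → ℤ) where

  private
    Bℚ : Fin n → Vector ℚ m
    Bℚ i k = toℚ (B i k)

  active : Vector ℚ m → Subset n
  active x = select (λ i → dotℚ (B i) x ℚ.≟ toℚ (c i))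

  -- Tightness supplies a lattice point xⱼ with bⱼ·xⱼ = cⱼ; writing bⱼ as a combination of
  -- the active bₗ gives cⱼ = bⱼ·xⱼ ≤ Σ λₗ cₗ = bⱼ·x.
  tight⇒cone-of-active-is-active : Tight B c → ∀ {x} → InP B c x →
    ∀ {j} → InCone B (active x) (Bℚ j) → dotℚ (B j) x ≡ toℚ (c j)
  tight⇒cone-of-active-is-active tight {x} x∈P {j} (λ′ , λ′≥0 , λ′∉ , bⱼ≡λ′B) =
    ℚ.≤-antisym (x∈P j) (begin
      toℚ (c j)                                   ≡⟨ cong toℚ xⱼ-attains ⟨
      toℚ (dotℤ (B j) xⱼ)                         ≡⟨ toℚ-dotℤ (B j) xⱼ ⟩
      dotℚ (B j) xⱼℚ                              ≡⟨ dot-lincomb Bℚ λ′ xⱼℚ bⱼ≡λ′B ⟩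
      sumℚ (λ l → λ′ l * dotℚ (B l) xⱼℚ)         ≤⟨ sumℚ-mono-≤ (λ l → *-monoˡ-≤-nonneg (λ′≥0 l) (xⱼ∈P l)) ⟩
      sumℚ (λ l → λ′ l * toℚ (c l))              ≡⟨ sumℚ-cong λ′c≡λ′Bx ⟩
      sumℚ (λ l → λ′ l * dotℚ (B l) x)           ≡⟨ dot-lincomb Bℚ λ′ x bⱼ≡λ′B ⟨
      dotℚ (B j) x                                ∎)
    where
    open ℚ.≤-Reasoning
    xⱼ = proj₁ (tight j)
    xⱼℚ : Vector ℚ m
    xⱼℚ k = toℚ (xⱼ k)
    xⱼ-attains : dotℤ (B j) xⱼ ≡ c j
    xⱼ-attains = proj₂ (proj₂ (tight j))
    xⱼ∈P : InP B c xⱼℚ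
    xⱼ∈P l = subst (_≤ toℚ (c l)) (toℚ-dotℤ (B l) xⱼ) (toℚ-mono-≤ (proj₁ (proj₂ (tight j)) l))
    λ′c≡λ′Bx : ∀ l → λ′ l * toℚ (c l) ≡ λ′ l * dotℚ (B l) x
    λ′c≡λ′Bx l with l ∈? active x
    ... | yes l∈ = cong (λ′ l *_) (sym (∈-select⁻ (λ i → dotℚ (B i) x ℚ.≟ toℚ (c i)) l∈))
    ... | no  l∉ = begin-equality
      λ′ l * toℚ (c l)        ≡⟨ cong (_* toℚ (c l)) (λ′∉ l l∉) ⟩
      0ℚ * toℚ (c l)          ≡⟨ ℚ.*-zeroˡ (toℚ (c l)) ⟩
      0ℚ                      ≡⟨ ℚ.*-zeroˡ (dotℚ (B l) x) ⟨
      0ℚ * dotℚ (B l) x       ≡⟨ cong (_* dotℚ (B l) x) (λ′∉ l l∉) ⟨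
      λ′ l * dotℚ (B l) x     ∎

  integral-dual-optimum : Supernormal B → Tight B c → ∀ {w x y} → InP B c x →
    IsDualFeasible Bℚ (λ k → toℚ (w k)) y → dualValue c y ≤ dotℚ w x → HasIntegralDualOpt B c w
  integral-dual-optimum supernormal tight {w} {x} {y} x∈P y-dual@(y≥0 , w≡yB) yc≤wx = μℤ , μ-dual , μ-optimal
    where
    y-vanishes : ∀ i → i ∉ active x → y i ≡ 0ℚ
    y-vanishes i i∉ = complementary-slackness Bℚ x∈P y-dual yc≤wx i
      (λ i-active → i∉ (∈-select⁺ (λ i → dotℚ (B i) x ℚ.≟ toℚ (c i)) i-active))
    integral = supernormal (active x) w (y , y≥0 , y-vanishes , w≡yB)
    μ = proj₁ integral
    μℤ : Vector ℤ n
    μℤ j = ℤ.+ μ j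
    μℚ : Vector ℚ n
    μℚ j = toℚ (μℤ j)
    μ-dual : DualFeasible B w μℚ
    μ-dual = (λ j → toℚ-mono-≤ {ℤ.+ 0} {μℤ j} (ℤ.+≤+ ℕ.z≤n)) , λ k → toℚ-lincomb μℤ B k (proj₂ (proj₂ integral) k)
    μc≡μBx : ∀ j → μℚ j * toℚ (c j) ≡ μℚ j * dotℚ (B j) x
    μc≡μBx j = toℚ-*-cong-≢0 (μ j) (λ μⱼ≢0 → sym (tight⇒cone-of-active-is-active tight x∈P (proj₁ (proj₂ integral) j μⱼ≢0)))
    μ-optimal : ∀ y′ → DualFeasible B w y′ → dualValue c μℚ ≤ dualValue c y′
    μ-optimal y′ y′-dual = begin
      dualValue c μℚ                          ≡⟨ sumℚ-cong μc≡μBx ⟩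
      sumℚ (λ j → μℚ j * dotℚ (B j) x)       ≡⟨ dot-lincomb Bℚ μℚ x (proj₂ μ-dual) ⟨
      dotℚ w x                                ≤⟨ weak-duality Bℚ x∈P y′-dual ⟩
      dualValue c y′                          ∎
      where open ℚ.≤-Reasoning

supernormal⇒TDI : ∀ (B : Config m n) → Supernormal B → ∀ c → Tight B c → TDI B c
supernormal⇒TDI B supernormal c tight w ((x₀ , x₀∈P) , (M , bounded)) =
  let x , y , x∈P , y-dual , yc≤wx = strong-duality (λ i k → toℚ (B i k)) (λ i → toℚ (c i)) (λ k → toℚ (w k)) x₀∈P bounded
  in integral-dual-optimum B c supernormal tight {w} x∈P y-dual yc≤wx

-- Total dual integrality of all tight systems forces supernormality

toℚ-↥ : ∀ q → toℚ (ℚ.↥ q) ≡ toℚ (ℚ.↧ q) * q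
toℚ-↥ q@(mkℚ i d-1 _) = ℚ.toℚᵘ-injective (begin
  ℚ.toℚᵘ (toℚ i)                                 ≈⟨ toℚᵘ-toℚ i ⟩
  ℚᵘ.mkℚᵘ i 0                                    ≈⟨ ℚᵘ.*≡* i*d≡d*i*1 ⟩
  ℚᵘ.mkℚᵘ (ℚ.↧ q) 0 ℚᵘ.* ℚ.toℚᵘ q               ≈⟨ ℚᵘ.*-cong (ℚᵘ.≃-sym (toℚᵘ-toℚ (ℚ.↧ q))) (ℚᵘ.≃-refl {ℚ.toℚᵘ q}) ⟩
  ℚ.toℚᵘ (toℚ (ℚ.↧ q)) ℚᵘ.* ℚ.toℚᵘ q            ≈⟨ ℚᵘ.≃-sym (ℚ.toℚᵘ-homo-* (toℚ (ℚ.↧ q)) q) ⟩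
  ℚ.toℚᵘ (toℚ (ℚ.↧ q) * q)                       ∎)
  where
  open import Relation.Binary.Reasoning.Setoid ℚᵘ.≃-setoid
  i*d≡d*i*1 : i ℤ.* ℤ.+ suc (d-1 ℕ.+ 0) ≡ (ℚ.↧ q ℤ.* i) ℤ.* ℤ.+ 1
  i*d≡d*i*1 = trans (cong (λ e → i ℤ.* ℤ.+ suc e) (ℕ.+-identityʳ d-1))
    (solve 2 (λ i d → i :* d := (d :* i) :* con (ℤ.+ 1)) refl i (ℚ.↧ q))
    where open ℤ-Solver

integral-multiple : ∀ (d : Vector ℚ m) → Σ[ D ∈ ℕ ] Σ[ x ∈ Vector ℤ m ] ∀ k → toℚ (x k) ≡ toℚ (ℤ.+ suc D) * d k
integral-multiple {zero}  d = 0 , (λ ()) , λ ()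
integral-multiple {suc m} d with integral-multiple (λ k → d (suc k))
... | D , x , x≡Dd = D″ , x′ , x′≡D′d
  where
  open ≡-Reasoning
  open ℚ-Solver
  swap : ∀ a q b → a * q * b ≡ a * b * q
  swap = solve 3 (λ a q b → a :* q :* b := a :* b :* q) refl
  q = d zero
  D″ = D ℕ.+ ℚ.denominator-1 q ℕ.* suc D
  D′ = toℚ (ℚ.↧ q) * toℚ (ℤ.+ suc D)
  D′≡ : toℚ (ℤ.+ suc D″) ≡ D′
  D′≡ = trans (cong toℚ (ℤ.pos-* (ℚ.↧ₙ q) (suc D))) (toℚ-* (ℚ.↧ q) (ℤ.+ suc D))
  x′ : Vector ℤ (suc m)
  x′ zero    = ℚ.↥ q ℤ.* ℤ.+ suc D
  x′ (suc k) = ℚ.↧ q ℤ.* x k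
  x′≡D′d : ∀ k → toℚ (x′ k) ≡ toℚ (ℤ.+ suc D″) * d k
  x′≡D′d zero = begin
    toℚ (ℚ.↥ q ℤ.* ℤ.+ suc D)                    ≡⟨ toℚ-* (ℚ.↥ q) (ℤ.+ suc D) ⟩
    toℚ (ℚ.↥ q) * toℚ (ℤ.+ suc D)               ≡⟨ cong (_* toℚ (ℤ.+ suc D)) (toℚ-↥ q) ⟩
    toℚ (ℚ.↧ q) * q * toℚ (ℤ.+ suc D)           ≡⟨ swap (toℚ (ℚ.↧ q)) q (toℚ (ℤ.+ suc D)) ⟩
    D′ * q                                       ≡⟨ cong (_* q) D′≡ ⟨
    toℚ (ℤ.+ suc D″) * q                         ∎
  x′≡D′d (suc k) = begin
    toℚ (ℚ.↧ q ℤ.* x k)                          ≡⟨ toℚ-* (ℚ.↧ q) (x k) ⟩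
    toℚ (ℚ.↧ q) * toℚ (x k)                     ≡⟨ cong (toℚ (ℚ.↧ q) *_) (x≡Dd k) ⟩
    toℚ (ℚ.↧ q) * (toℚ (ℤ.+ suc D) * d (suc k)) ≡⟨ ℚ.*-assoc (toℚ (ℚ.↧ q)) _ _ ⟨
    D′ * d (suc k)                               ≡⟨ cong (_* d (suc k)) D′≡ ⟨
    toℚ (ℤ.+ suc D″) * d (suc k)                 ∎

max₀ : Vector ℤ n → ℤ
max₀ f = ℤ-max (ℤ.+ 0) (List.tabulate f)

max₀-ub : ∀ (f : Vector ℤ n) j → f j ℤ.≤ max₀ f
max₀-ub f j = All.lookup (ℤ-xs≤max (ℤ.+ 0) (List.tabulate f)) (∈-tabulate⁺ j)

max₀-nonneg : ∀ (f : Vector ℤ n) → ℤ.+ 0 ℤ.≤ max₀ f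
max₀-nonneg f = ℤ-⊥≤max (ℤ.+ 0) (List.tabulate f)

max₀-nonpos : ∀ (f : Vector ℤ n) → (∀ j → f j ℤ.≤ ℤ.+ 0) → max₀ f ≡ ℤ.+ 0
max₀-nonpos f f≤0 = ℤ.≤-antisym (ℤ-max≤v⁺ ℤ.≤-refl (All.tabulate⁺ f≤0)) (max₀-nonneg f)

max₀-attained : ∀ (f : Vector ℤ n) → max₀ f ≡ ℤ.+ 0 ⊎ Σ[ j ∈ Fin n ] max₀ f ≡ f j
max₀-attained f with ℤ-argmax-sel id (ℤ.+ 0) (List.tabulate f)
... | inj₁ max≡0 = inj₁ max≡0
... | inj₂ max∈f = inj₂ (∈-tabulate⁻ max∈f)

dot-scaled : ∀ (a d x : Vector ℚ n) s → (∀ k → x k ≡ s * d k) → dot a x ≡ s * dot a d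
dot-scaled a d x s x≡sd = begin
  dot a x                  ≡⟨ dot-comm a x ⟩
  dot x a                  ≡⟨ sumℚ-cong (λ k → cong (_* a k) (x≡sd k)) ⟩
  dot (λ k → s * d k) a    ≡⟨ dot-*ˡ s d a ⟩
  s * dot d a              ≡⟨ cong (s *_) (dot-comm d a) ⟩
  s * dot a d              ∎
  where open ≡-Reasoning

dotℤ-zeroʳ : ∀ (b : Vector ℤ n) → dotℤ b (λ _ → ℤ.+ 0) ≡ ℤ.+ 0
dotℤ-zeroʳ {zero}  b = refl
dotℤ-zeroʳ {suc n} b = cong₂ ℤ._+_ (ℤ.*-zeroʳ (b zero)) (dotℤ-zeroʳ (λ k → b (suc k)))

integral-separator : ∀ (B : Config m n) S (b : Vector ℤ m) →
  Σ[ X ∈ Vector ℤ m ] (∀ i → i ∈ S → dotℤ (B i) X ℤ.≤ ℤ.+ 0) ×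
    (InCone B S (λ k → toℚ (b k)) ⊎ ℤ.+ 0 ℤ.< dotℤ b X)
integral-separator {m} B S b =
  [ (λ b∈cone → (λ _ → ℤ.+ 0) , (λ i _ → ℤ.≤-reflexive (dotℤ-zeroʳ (B i))) , inj₁ b∈cone) , integral ]′
  (cone-or-separated B S (λ k → toℚ (b k)))
  where
  integral : Separated B S (λ k → toℚ (b k)) →
    Σ[ X ∈ Vector ℤ m ] (∀ i → i ∈ S → dotℤ (B i) X ℤ.≤ ℤ.+ 0) × (InCone B S (λ k → toℚ (b k)) ⊎ ℤ.+ 0 ℤ.< dotℤ b X)
  integral (d , Bd≤0 , 0<bd) =
    let D , X , X≡sd = integral-multiple d
        s = toℚ (ℤ.+ suc D)
        0<s : 0ℚ < s
        0<s = toℚ-mono-< {ℤ.+ 0} {ℤ.+ suc D} (ℤ.+<+ (ℕ.s≤s ℕ.z≤n))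
        dotℤ-scaled : ∀ a → toℚ (dotℤ a X) ≡ s * dotℚ a d
        dotℤ-scaled a = trans (toℚ-dotℤ a X) (dot-scaled (λ k → toℚ (a k)) d (λ k → toℚ (X k)) s X≡sd)
    in X ,
       (λ i i∈S → toℚ-cancel-≤ {dotℤ (B i) X} {ℤ.+ 0} (subst₂ _≤_ (sym (dotℤ-scaled (B i))) (ℚ.*-zeroʳ s)
          (*-monoˡ-≤-nonneg (ℚ.<⇒≤ 0<s) (Bd≤0 i i∈S)))) ,
       inj₂ (toℚ-cancel-< {ℤ.+ 0} {dotℤ b X} (subst (0ℚ <_) (sym (dotℤ-scaled b)) (*-pos 0<s 0<bd)))

disjoint-supports : ∀ (S : Subset n) (l c : Vector ℚ n) →
  (∀ i → i ∉ S → l i ≡ 0ℚ) → (∀ i → i ∈ S → c i ≡ 0ℚ) → sumℚ (λ i → l i * c i) ≡ 0ℚ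
disjoint-supports {n} S l c l∉S≡0 c∈S≡0 = trans (sumℚ-cong lᵢcᵢ≡0) (sumℚ-zero {n})
  where
  lᵢcᵢ≡0 : ∀ i → l i * c i ≡ 0ℚ
  lᵢcᵢ≡0 i with i ∈? S
  ... | yes i∈S = trans (cong (l i *_) (c∈S≡0 i i∈S)) (ℚ.*-zeroʳ (l i))
  ... | no  i∉S = trans (cong (_* c i) (l∉S≡0 i i∉S)) (ℚ.*-zeroˡ (c i))

module _ (B : Config m n) (tdi : ∀ c → Tight B c → TDI B c) where

  private
    Bℚ : Fin n → Vector ℚ m
    Bℚ i k = toℚ (B i k)

    -- cᵢ = max(0, maxⱼ bᵢ·Xⱼ) vanishes on S, so z·x ≤ 0 on P_c and an integral optimal dual y
    -- has y·c = 0; since cⱼ ≥ bⱼ·Xⱼ > 0 for bⱼ ∉ cone(S), such yⱼ vanish.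
    module Witness (S : Subset n) (z : Vector ℤ m) (z∈cone : InCone B S (λ k → toℚ (z k))) where

      separator : ∀ j → Σ[ X ∈ Vector ℤ m ] (∀ i → i ∈ S → dotℤ (B i) X ℤ.≤ ℤ.+ 0) ×
                          (InCone B S (Bℚ j) ⊎ ℤ.+ 0 ℤ.< dotℤ (B j) X)
      separator j = integral-separator B S (B j)

      X : Fin n → Vector ℤ m
      X j = proj₁ (separator j)

      c : Fin n → ℤ
      c i = max₀ (λ j → dotℤ (B i) (X j))

      c≥0 : ∀ i → 0ℚ ≤ toℚ (c i)
      c≥0 i = toℚ-mono-≤ {ℤ.+ 0} {c i} (max₀-nonneg (λ j → dotℤ (B i) (X j)))

      tight : Tight B c
      tight i = [ attained-at-0 , attained-at-X ]′ (max₀-attained (λ j → dotℤ (B i) (X j)))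
        where
        attained-at-0 : c i ≡ ℤ.+ 0 → Σ[ x ∈ Vector ℤ m ] InPℤ B c x × dotℤ (B i) x ≡ c i
        attained-at-0 cᵢ≡0 = (λ _ → ℤ.+ 0) ,
          (λ l → subst (ℤ._≤ c l) (sym (dotℤ-zeroʳ (B l))) (max₀-nonneg (λ j → dotℤ (B l) (X j)))) ,
          trans (dotℤ-zeroʳ (B i)) (sym cᵢ≡0)
        attained-at-X : Σ[ j ∈ Fin n ] c i ≡ dotℤ (B i) (X j) → Σ[ x ∈ Vector ℤ m ] InPℤ B c x × dotℤ (B i) x ≡ c i
        attained-at-X (j , cᵢ≡bᵢXⱼ) = X j , (λ l → max₀-ub (λ j → dotℤ (B l) (X j)) j) , sym cᵢ≡bᵢXⱼ

      λ′ = proj₁ z∈cone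
      λ′-dual : IsDualFeasible Bℚ (λ k → toℚ (z k)) λ′
      λ′-dual = proj₁ (proj₂ z∈cone) , proj₂ (proj₂ (proj₂ z∈cone))

      λ′c≡0 : dualValue c λ′ ≡ 0ℚ
      λ′c≡0 = disjoint-supports S λ′ (λ i → toℚ (c i)) (proj₁ (proj₂ (proj₂ z∈cone)))
        (λ i i∈S → cong toℚ (max₀-nonpos (λ j → dotℤ (B i) (X j)) (λ j → proj₁ (proj₂ (separator j)) i i∈S)))

      max-finite : MaxFinite B c z
      max-finite = ((λ _ → 0ℚ) , λ i → subst (_≤ toℚ (c i)) (sym (dot-zeroʳ (Bℚ i))) (c≥0 i)) ,
                   (0ℚ , λ x x∈P → subst (dotℚ z x ≤_) λ′c≡0 (weak-duality Bℚ x∈P λ′-dual))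

      integral-dual = tdi c tight z max-finite
      y = proj₁ integral-dual

      y≥0 : ∀ j → 0ℚ ≤ toℚ (y j)
      y≥0 = proj₁ (proj₁ (proj₂ integral-dual))

      yᵢcᵢ≡0 : ∀ j → toℚ (y j) * toℚ (c j) ≡ 0ℚ
      yᵢcᵢ≡0 = sumℚ≤0⇒≡0 (λ j → *-nonneg (y≥0 j) (c≥0 j))
        (subst (dualValue c (λ j → toℚ (y j)) ≤_) λ′c≡0 (proj₂ (proj₂ integral-dual) λ′ λ′-dual))

      μ : Fin n → ℕ
      μ j = ℤ.∣ y j ∣

      +μ≡y : ∀ j → ℤ.+ μ j ≡ y j
      +μ≡y j = ℤ.0≤i⇒+∣i∣≡i (toℚ-cancel-≤ {ℤ.+ 0} {y j} (y≥0 j))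

      y-vanishes : ∀ j → ℤ.+ 0 ℤ.< dotℤ (B j) (X j) → y j ≡ ℤ.+ 0
      y-vanishes j 0<bⱼXⱼ = toℚ-injective {y j} {ℤ.+ 0} (*≡0⇒≡0 (yᵢcᵢ≡0 j)
        (toℚ-mono-< (ℤ.<-≤-trans 0<bⱼXⱼ (max₀-ub (λ l → dotℤ (B j) (X l)) j))))

      μ∈cone : ∀ j → μ j ≢ 0 → InCone B S (Bℚ j)
      μ∈cone j μⱼ≢0 = [ id , (λ 0<bⱼXⱼ → ⊥-elim (μⱼ≢0 (cong ℤ.∣_∣ (y-vanishes j 0<bⱼXⱼ)))) ]′
        (proj₂ (proj₂ (separator j)))

      z≡μB : ∀ k → z k ≡ sumℤ (λ j → ℤ.+ μ j ℤ.* B j k)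
      z≡μB k = toℚ-injective {z k} {sumℤ (λ j → ℤ.+ μ j ℤ.* B j k)} (begin
        toℚ (z k)                                       ≡⟨ proj₂ (proj₁ (proj₂ integral-dual)) k ⟩
        sumℚ (λ j → toℚ (y j) * toℚ (B j k))           ≡⟨ sumℚ-cong (λ j → cong (λ e → toℚ e * toℚ (B j k)) (+μ≡y j)) ⟨
        sumℚ (λ j → toℚ (ℤ.+ μ j) * toℚ (B j k))       ≡⟨ toℚ-lincomb (λ j → ℤ.+ μ j) B k refl ⟨
        toℚ (sumℤ (λ j → ℤ.+ μ j ℤ.* B j k))           ∎)
        where open ≡-Reasoning

  TDI⇒supernormal : Supernormal B
  TDI⇒supernormal S z z∈cone = μ , μ∈cone , z≡μB
    where open Witness S z z∈cone

theorem3p6 : (m n : ℕ) (B : Config m n) → Injective _≡_ _≡_ B →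
    Supernormal B ⇔ ((c : Fin n → ℤ) → Tight B c → TDI B c)
theorem3p6 m n B _ = mk⇔ (supernormal⇒TDI B) (TDI⇒supernormal B)
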